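{- Let $k \geq 3$ and let $H$ be a finite $k$-uniform hypergraph with $\nu^{(k-1)}(H) = 2$. Then $$\tau^{(k-1)}(H) \leq 2\left\lceil \frac{k+1}{2} \right\rceil.$$
   Context: For a $k$-uniform hypergraph $H$ with vertex set $V$ and $1 \le m \le k-1$: an $m$-matching of $H$ is a set $M$ of edges of $H$ such that $|e \cap e'| < m$ for all distinct $e, e' \in M$; $\nu^{(m)}(H)$ is the maximum size of an $m$-matching. An $m$-cover of $H$ is a set $C \subseteq \binom{V}{m}$ of $m$-subsets of $V$ such that every edge of $H$ contains some member of $C$; $\tau^{(m)}(H)$ is the minimum size of an $m$-cover. -}

module Defs where

open import Data.Nat using (ℕ; _<_; _∸_)
open import Data.Fin.Subset using (Subset; _∩_; _⊆_; ∣_∣)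
open import Data.List using (List; length)
open import Data.List.Membership.Propositional using (_∈_)
open import Data.List.Relation.Unary.All using (All)
open import Data.List.Relation.Unary.AllPairs using (AllPairs)
open import Data.List.Relation.Unary.Unique.Propositional using (Unique)
open import Data.Product using (_×_; Σ-syntax; ∃-syntax)
open import Relation.Binary.PropositionalEquality using (_≡_; _≢_)

record Hypergraph (n k : ℕ) : Set where
  field
    edges   : List (Subset n)
    unique  : Unique edges
    uniform : All (λ e → ∣ e ∣ ≡ k) edges
open Hypergraph public

IsMatching : ∀ {n k} → ℕ → Hypergraph n k → List (Subset n) → Set
IsMatching m H M =
  All (λ e → e ∈ edges H) M ×
  AllPairs (λ e e' → e ≢ e' × ∣ e ∩ e' ∣ < m) M

ν≡ : ∀ {n k} → ℕ → Hypergraph n k → ℕ → Set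
ν≡ m H t =
  (∃[ M ] (IsMatching m H M × length M ≡ t)) ×
  (∀ M → IsMatching m H M → length M Data.Nat.≤ t)

IsCover : ∀ {n k} → ℕ → Hypergraph n k → List (Subset n) → Set
IsCover m H C =
  All (λ c → ∣ c ∣ ≡ m) C ×
  (∀ e → e ∈ edges H → ∃[ c ] (c ∈ C × c ⊆ e))

τ≤ : ∀ {n k} → ℕ → Hypergraph n k → ℕ → Set
τ≤ m H b = ∃[ C ] (IsCover m H C × length C Data.Nat.≤ b)

-- Call two edges apart when they meet in fewer than k - 1 vertices; ν^(k-1)(H) = 2 says that no
-- three edges are pairwise apart. So the edges apart from a fixed edge pairwise share k - 1
-- vertices, and such a family of k-sets either has a common (k-1)-subset or lies inside a
-- (k+1)-set T, whose k-subsets are covered by the ⌈(k+1)/2⌉ sets T - x - y for a pairing {x, y}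
-- of the points of T.
--
-- If two edges meet in at most k - 3 vertices, every edge is apart from one of them and the two
-- families give the bound. Otherwise the matching edges e₁, e₂ meet in a (k-2)-set C, every edge
-- adjacent to both contains C, and edges through C adjacent to e₂ are covered by the two sets
-- C ∪ {a}, a ∈ e₂ - e₁. If every edge apart from e₁ (or from e₂) contains C, this gives
-- ⌈(k+1)/2⌉ + 2 sets. Otherwise all edges lie in the (k+2)-set e₁ ∪ e₂, and the shapes of the
-- families apart from e₁ and from e₂ combine to a cover; when both lie in (k+1)-sets, an edge
-- adjacent to e₁ and e₂ but contained in neither (k+1)-set would complete three pairwise apart
-- edges.

module Submission where

open import Defs
open import Data.Nat using (ℕ; zero; suc; _+_; _*_; _∸_; _≤_; _<_; _<?_; _≤?_; z≤n; s≤s; z<s; ⌈_/2⌉)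
open import Data.Nat.Properties
  using (+-cancelʳ-<; +-cancelʳ-≡; +-cancelʳ-≤; +-cancelˡ-<; +-cancelˡ-≤; +-comm; +-identityʳ;
         +-mono-≤; +-monoʳ-≤; +-monoˡ-≤; +-suc; <⇒≱; >⇒≢; m<n⇒0<n; m≤n⇒m≤1+n; n≤0⇒n≡0; n≤1+n;
         suc-injective; ≤-<-trans; ≤-antisym; ≤-pred; ≤-refl; ≤-reflexive; ≤-trans; ≮⇒≥; ≰⇒>; module ≤-Reasoning)
open import Data.Nat.Tactic.RingSolver using (solve-∀)
open import Data.Fin using (Fin)
open import Data.Fin.Properties using (_≟_)
open import Data.Vec using ([]; _∷_)
open import Data.Vec.Properties using (≡-dec)
import Data.Bool.Properties as Bool
open import Data.List using (List; []; _∷_; length; _++_; filter)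
open import Data.List.Properties using (length-++)
open import Data.List.Relation.Unary.All using (All; []; _∷_)
import Data.List.Relation.Unary.All as All
open import Data.List.Relation.Unary.All.Properties using (++⁺)
open import Data.List.Relation.Unary.AllPairs using ([]; _∷_)
open import Data.List.Relation.Unary.Any using (Any; any?; here; there)
open import Data.List.Membership.Propositional using (_∈_; find; lose)
open import Data.List.Membership.Propositional.Properties using (∈-++⁺ˡ; ∈-++⁺ʳ; ∈-filter⁺; ∈-filter⁻)
open import Data.Fin.Subset
  using (Subset; _∩_; _∪_; _─_; _-_; ∁; ⊥; ⁅_⁆; ∣_∣; _⊆_; Nonempty)
  renaming (_∈_ to _∈ₛ_; _∉_ to _∉ₛ_)
open import Data.Fin.Subset.Properties
  using (Empty-unique; nonempty?; p∩q⊆p; p∩q⊆q; p⊆p∪q; p─q⊆p; p─x─y≡p─y─x; q⊆p∪q; x∈p⇒∣p-x∣<∣p∣;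
         x∈p∧x≢y⇒x∈p-y; x∈p∩q⁺; x∈⁅x⁆; x∈⁅y⁆⇒x≡y; x∈∁p⇒x∉p; x∉p⇒x∈∁p; x≢y⇒x∉⁅y⁆; ∉⊥; ∣p∩q∣≤∣q∣;
         ∣⁅x⁆∣≡1; ∣⊥∣≡0; ∩-comm; ∩-idem; ∪-comm; ⊆-antisym; ⊆-refl; ⊆-reflexive; ⊆-trans; _⊆?_; _∈?_)
open import Data.Product using (∃; ∃₂; ∃-syntax; _×_; _,_; proj₁; proj₂)
open import Data.Sum using (_⊎_; inj₁; inj₂)
open import Data.Empty using (⊥-elim)
open import Function using (id; _∘_)
open import Relation.Binary.PropositionalEquality
  using (_≡_; _≢_; refl; sym; trans; cong; cong₂; subst; subst₂; module ≡-Reasoning)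
open import Relation.Nullary using (Dec; ¬_; yes; no; contradiction; ¬?)
open import Relation.Nullary.Decidable using (_×-dec_; decidable-stable)

-- Inclusions and linear (in)equalities between cardinalities of Boolean combinations of
-- finitely many subsets hold as soon as they hold at each point, where every set contributes
-- one Boolean: venn-⊆, venn-≤ and venn-≡ reduce them to a truth table over the variables,
-- which is evaluated when the implicit Tautology argument is solved (it reduces to ⊤).
module Venn where

  open import Data.Nat using (_≤ᵇ_; _≡ᵇ_)
  open import Data.Nat.Properties using (≤ᵇ⇒≤; ≡ᵇ⇒≡; +-commutativeSemigroup)
  open import Algebra.Properties.CommutativeSemigroup +-commutativeSemigroup using (interchange)
  open import Data.Bool using (Bool; true; false; _∧_; _∨_; not; T; if_then_else_)
  open import Data.Bool.Properties using (T-∧; ∧-zeroʳ; ∧-identityʳ)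
  open import Data.Fin using (zero; suc)
  open import Data.Vec using (Vec; lookup; map; head; tail; here)
  open import Data.Vec.Properties using (lookup-map)
  open import Data.Fin.Subset.Properties using (drop-∷-⊆; out⊆; in⊆in)
  open import Data.Unit using (tt)
  open import Function.Bundles using (Equivalence)

  private variable n m : ℕ

  infix  8 ~_
  infixr 7 _&_
  infixr 6 _∥_
  infixl 6 _∖_
  infix  5.5 _⊑_

  data Expr (m : ℕ) : Set where
    var         : Fin m → Expr m
    ∅           : Expr m
    _&_ _∥_ _∖_ : Expr m → Expr m → Expr m
    ~_          : Expr m → Expr m

  data Inclusion (m : ℕ) : Set where
    _⊑_ : Expr m → Expr m → Inclusion m

  ⟦_⟧ : Expr m → Vec (Subset n) m → Subset n
  ⟦ var i ⟧ ρ = lookup ρ i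
  ⟦ ∅ ⟧     ρ = ⊥
  ⟦ a & b ⟧ ρ = ⟦ a ⟧ ρ ∩ ⟦ b ⟧ ρ
  ⟦ a ∥ b ⟧ ρ = ⟦ a ⟧ ρ ∪ ⟦ b ⟧ ρ
  ⟦ a ∖ b ⟧ ρ = ⟦ a ⟧ ρ ─ ⟦ b ⟧ ρ
  ⟦ ~ a ⟧   ρ = ∁ (⟦ a ⟧ ρ)

  Holds : Inclusion m → Vec (Subset n) m → Set
  Holds (a ⊑ b) ρ = ⟦ a ⟧ ρ ⊆ ⟦ b ⟧ ρ

  -- A one-term sum is the bare cardinality, so that no "+ 0" shows up in statements.
  Σ∣_∣ : List (Expr m) → Vec (Subset n) m → ℕ
  Σ∣ [] ∣          ρ = 0
  Σ∣ a ∷ [] ∣      ρ = ∣ ⟦ a ⟧ ρ ∣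
  Σ∣ a ∷ b ∷ as ∣  ρ = ∣ ⟦ a ⟧ ρ ∣ + Σ∣ b ∷ as ∣ ρ

  v0 : ∀ {m} → Expr (1 + m)
  v0 = var zero
  v1 : ∀ {m} → Expr (2 + m)
  v1 = var (suc zero)
  v2 : ∀ {m} → Expr (3 + m)
  v2 = var (suc (suc zero))
  v3 : ∀ {m} → Expr (4 + m)
  v3 = var (suc (suc (suc zero)))
  v4 : ∀ {m} → Expr (5 + m)
  v4 = var (suc (suc (suc (suc zero))))
  v5 : ∀ {m} → Expr (6 + m)
  v5 = var (suc (suc (suc (suc (suc zero)))))
  v6 : ∀ {m} → Expr (7 + m)
  v6 = var (suc (suc (suc (suc (suc (suc zero))))))
  v7 : ∀ {m} → Expr (8 + m)
  v7 = var (suc (suc (suc (suc (suc (suc (suc zero)))))))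

  private

    eval : Expr m → Vec Bool m → Bool
    eval (var i) v = lookup v i
    eval ∅       v = false
    eval (a & b) v = eval a v ∧ eval b v
    eval (a ∥ b) v = eval a v ∨ eval b v
    eval (a ∖ b) v = eval a v ∧ not (eval b v)
    eval (~ a)   v = not (eval a v)

    holds : Inclusion m → Vec Bool m → Bool
    holds (a ⊑ b) v = not (eval a v) ∨ eval b v

    allHold : List (Inclusion m) → Vec Bool m → Bool
    allHold []       v = true
    allHold (h ∷ hs) v = holds h v ∧ allHold hs v

    count : List (Expr m) → Vec Bool m → ℕ
    count []       v = 0
    count (a ∷ as) v = (if eval a v then 1 else 0) + count as v

    _⇒ᵇ_ : Bool → Bool → Bool
    true  ⇒ᵇ b = b
    false ⇒ᵇ b = true

    everywhere : (m : ℕ) → (Vec Bool m → Bool) → Bool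
    everywhere zero    P = P []
    everywhere (suc m) P = everywhere m (λ v → P (true ∷ v)) ∧ everywhere m (λ v → P (false ∷ v))

    everywhere-sound : ∀ m P → T (everywhere m P) → ∀ v → T (P v)
    everywhere-sound zero    P t []          = t
    everywhere-sound (suc m) P t (true ∷ v)  = everywhere-sound m _ (proj₁ (Equivalence.to T-∧ t)) v
    everywhere-sound (suc m) P t (false ∷ v) =
      everywhere-sound m _ (proj₂ (Equivalence.to (T-∧ {everywhere m (λ w → P (true ∷ w))}) t)) v

    Tautology : (m : ℕ) → List (Inclusion m) → (Vec Bool m → Bool) → Set
    Tautology m hs claim = T (everywhere m (λ v → allHold hs v ⇒ᵇ claim v))

    column : Vec (Subset (suc n)) m → Vec Bool m
    column = map head

    rest : Vec (Subset (suc n)) m → Vec (Subset n) m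
    rest = map tail

    diff-∷ : ∀ s t (p q : Subset n) → (s ∷ p) ─ (t ∷ q) ≡ (s ∧ not t) ∷ (p ─ q)
    diff-∷ s     true  p q = cong (_∷ _) (sym (∧-zeroʳ s))
    diff-∷ s     false p q = cong (_∷ _) (sym (∧-identityʳ s))

    ⟦⟧-∷ : (a : Expr m) (ρ : Vec (Subset (suc n)) m) → ⟦ a ⟧ ρ ≡ eval a (column ρ) ∷ ⟦ a ⟧ (rest ρ)
    ⟦⟧-∷ (var i) ρ rewrite lookup-map i head ρ | lookup-map i tail ρ with lookup ρ i
    ... | b ∷ p = refl
    ⟦⟧-∷ ∅       ρ = refl
    ⟦⟧-∷ (a & b) ρ rewrite ⟦⟧-∷ a ρ | ⟦⟧-∷ b ρ = refl
    ⟦⟧-∷ (a ∥ b) ρ rewrite ⟦⟧-∷ a ρ | ⟦⟧-∷ b ρ = refl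
    ⟦⟧-∷ (a ∖ b) ρ rewrite ⟦⟧-∷ a ρ | ⟦⟧-∷ b ρ = diff-∷ (eval a (column ρ)) (eval b (column ρ)) _ _
    ⟦⟧-∷ (~ a)   ρ rewrite ⟦⟧-∷ a ρ = refl

    ⊆-∷⁻ : ∀ {s t} {p q : Subset n} → s ∷ p ⊆ t ∷ q → T (not s ∨ t) × p ⊆ q
    ⊆-∷⁻ {s = false} sub = tt , drop-∷-⊆ sub
    ⊆-∷⁻ {s = true} {t = true} sub = tt , drop-∷-⊆ sub
    ⊆-∷⁻ {s = true} {t = false} sub with sub here
    ... | ()

    ⊆-∷⁺ : ∀ {s t} {p q : Subset n} → T (not s ∨ t) → p ⊆ q → s ∷ p ⊆ t ∷ q
    ⊆-∷⁺ {s = false} _ = out⊆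
    ⊆-∷⁺ {s = true} {t = true} _ = in⊆in

    holds-∷⁻ : (h : Inclusion m) (ρ : Vec (Subset (suc n)) m) →
               Holds h ρ → T (holds h (column ρ)) × Holds h (rest ρ)
    holds-∷⁻ (a ⊑ b) ρ sub rewrite ⟦⟧-∷ a ρ | ⟦⟧-∷ b ρ = ⊆-∷⁻ sub

    allHold-∷⁻ : (hs : List (Inclusion m)) (ρ : Vec (Subset (suc n)) m) →
                 All (λ h → Holds h ρ) hs → T (allHold hs (column ρ)) × All (λ h → Holds h (rest ρ)) hs
    allHold-∷⁻ []       ρ []         = tt , []
    allHold-∷⁻ (h ∷ hs) ρ (hρ ∷ hsρ) with holds-∷⁻ h ρ hρ | allHold-∷⁻ hs ρ hsρ
    ... | hc , hr | hsc , hsr = Equivalence.from T-∧ (hc , hsc) , hr ∷ hsr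

    claim-at : ∀ {hs : List (Inclusion m)} {claim} → Tautology m hs claim → ∀ v → T (allHold hs v) → T (claim v)
    claim-at {m} {hs} taut v hv with allHold hs v | everywhere-sound m _ taut v
    ... | true | c = c

    total : List (Expr m) → Vec (Subset n) m → ℕ
    total []       ρ = 0
    total (a ∷ as) ρ = ∣ ⟦ a ⟧ ρ ∣ + total as ρ

    Σ∣∣≡total : (as : List (Expr m)) (ρ : Vec (Subset n) m) → Σ∣ as ∣ ρ ≡ total as ρ
    Σ∣∣≡total []           ρ = refl
    Σ∣∣≡total (a ∷ [])     ρ = sym (+-identityʳ _)
    Σ∣∣≡total (a ∷ b ∷ as) ρ = cong (∣ ⟦ a ⟧ ρ ∣ +_) (Σ∣∣≡total (b ∷ as) ρ)

    ∣∷∣ : ∀ b (p : Subset n) → ∣ b ∷ p ∣ ≡ (if b then 1 else 0) + ∣ p ∣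
    ∣∷∣ true  p = refl
    ∣∷∣ false p = refl

    total-∷ : (as : List (Expr m)) (ρ : Vec (Subset (suc n)) m) →
              total as ρ ≡ count as (column ρ) + total as (rest ρ)
    total-∷ []       ρ = refl
    total-∷ (a ∷ as) ρ rewrite ⟦⟧-∷ a ρ | ∣∷∣ (eval a (column ρ)) (⟦ a ⟧ (rest ρ)) | total-∷ as ρ =
      interchange (if eval a (column ρ) then 1 else 0) _ _ _

    total-[] : (as : List (Expr m)) (ρ : Vec (Subset zero) m) → total as ρ ≡ 0
    total-[] []       ρ = refl
    total-[] (a ∷ as) ρ with ⟦ a ⟧ ρ
    ... | [] = total-[] as ρ

    venn-total-≤ : (ρ : Vec (Subset n) m) (hs : List (Inclusion m)) (ls rs : List (Expr m)) →
                   All (λ h → Holds h ρ) hs → Tautology m hs (λ v → count ls v ≤ᵇ count rs v) →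
                   total ls ρ ≤ total rs ρ
    venn-total-≤ {zero} ρ hs ls rs _ _ rewrite total-[] ls ρ = z≤n
    venn-total-≤ {suc n} ρ hs ls rs hρ taut rewrite total-∷ ls ρ | total-∷ rs ρ with allHold-∷⁻ hs ρ hρ
    ... | hc , hr = +-mono-≤ (≤ᵇ⇒≤ _ _ (claim-at {hs = hs} {λ v → count ls v ≤ᵇ count rs v} taut (column ρ) hc))
                             (venn-total-≤ (rest ρ) hs ls rs hr taut)

    venn-total-≡ : (ρ : Vec (Subset n) m) (hs : List (Inclusion m)) (ls rs : List (Expr m)) →
                   All (λ h → Holds h ρ) hs → Tautology m hs (λ v → count ls v ≡ᵇ count rs v) →
                   total ls ρ ≡ total rs ρ
    venn-total-≡ {zero} ρ hs ls rs _ _ rewrite total-[] ls ρ | total-[] rs ρ = refl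
    venn-total-≡ {suc n} ρ hs ls rs hρ taut rewrite total-∷ ls ρ | total-∷ rs ρ with allHold-∷⁻ hs ρ hρ
    ... | hc , hr = cong₂ _+_ (≡ᵇ⇒≡ _ _ (claim-at {hs = hs} {λ v → count ls v ≡ᵇ count rs v} taut (column ρ) hc))
                              (venn-total-≡ (rest ρ) hs ls rs hr taut)

  venn-⊆ : (ρ : Vec (Subset n) m) (hs : List (Inclusion m)) (c : Inclusion m) →
           All (λ h → Holds h ρ) hs → {Tautology m hs (holds c)} → Holds c ρ
  venn-⊆ {zero} ρ hs (a ⊑ b) _ {_} {()}
  venn-⊆ {suc n} ρ hs (a ⊑ b) hρ {taut} rewrite ⟦⟧-∷ a ρ | ⟦⟧-∷ b ρ with allHold-∷⁻ hs ρ hρ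
  ... | hc , hr = ⊆-∷⁺ (claim-at {hs = hs} {holds (a ⊑ b)} taut (column ρ) hc)
                       (venn-⊆ (rest ρ) hs (a ⊑ b) hr {taut})

  venn-≤ : (ρ : Vec (Subset n) m) (hs : List (Inclusion m)) (ls rs : List (Expr m)) →
           All (λ h → Holds h ρ) hs → {Tautology m hs (λ v → count ls v ≤ᵇ count rs v)} →
           Σ∣ ls ∣ ρ ≤ Σ∣ rs ∣ ρ
  venn-≤ ρ hs ls rs hρ {taut} =
    subst₂ _≤_ (sym (Σ∣∣≡total ls ρ)) (sym (Σ∣∣≡total rs ρ)) (venn-total-≤ ρ hs ls rs hρ taut)

  venn-≡ : (ρ : Vec (Subset n) m) (hs : List (Inclusion m)) (ls rs : List (Expr m)) →
           All (λ h → Holds h ρ) hs → {Tautology m hs (λ v → count ls v ≡ᵇ count rs v)} →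
           Σ∣ ls ∣ ρ ≡ Σ∣ rs ∣ ρ
  venn-≡ ρ hs ls rs hρ {taut} =
    trans (Σ∣∣≡total ls ρ) (trans (venn-total-≡ ρ hs ls rs hρ taut) (sym (Σ∣∣≡total rs ρ)))

open Venn

private variable n : ℕ

x∈p⇒⁅x⁆⊆p : ∀ {x} {p : Subset n} → x ∈ₛ p → ⁅ x ⁆ ⊆ p
x∈p⇒⁅x⁆⊆p {x = x} x∈p y∈⁅x⁆ = subst (_∈ₛ _) (sym (x∈⁅y⁆⇒x≡y x y∈⁅x⁆)) x∈p

x∉p⇒⁅x⁆⊆∁p : ∀ {x} {p : Subset n} → x ∉ₛ p → ⁅ x ⁆ ⊆ ∁ p
x∉p⇒⁅x⁆⊆∁p x∉p = x∈p⇒⁅x⁆⊆p (x∉p⇒x∈∁p x∉p)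

x≢y⇒⁅x⁆⊆∁⁅y⁆ : ∀ {x y : Fin n} → x ≢ y → ⁅ x ⁆ ⊆ ∁ ⁅ y ⁆
x≢y⇒⁅x⁆⊆∁⁅y⁆ x≢y = x∉p⇒⁅x⁆⊆∁p (x≢y⇒x∉⁅y⁆ x≢y)

∣p∣≡0⇒p⊆⊥ : {p : Subset n} → ∣ p ∣ ≡ 0 → p ⊆ ⊥
∣p∣≡0⇒p⊆⊥ {p = p} ∣p∣≡0 {x} x∈p = contradiction (subst (∣ p - x ∣ <_) ∣p∣≡0 (x∈p⇒∣p-x∣<∣p∣ x∈p)) λ ()

0<∣p∣⇒nonempty : (p : Subset n) → 0 < ∣ p ∣ → Nonempty p
0<∣p∣⇒nonempty {n} p 0<∣p∣ with nonempty? p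
... | yes ne = ne
... | no ¬ne = contradiction (trans (cong ∣_∣ (Empty-unique ¬ne)) (∣⊥∣≡0 n)) (>⇒≢ 0<∣p∣)

x∈p⇒0<∣p∣ : ∀ {x} {p : Subset n} → x ∈ₛ p → 0 < ∣ p ∣
x∈p⇒0<∣p∣ x∈p = m<n⇒0<n (x∈p⇒∣p-x∣<∣p∣ x∈p)

∣p∣≡1+k⇒nonempty : ∀ {k} (p : Subset n) → ∣ p ∣ ≡ suc k → Nonempty p
∣p∣≡1+k⇒nonempty p ∣p∣≡1+k = 0<∣p∣⇒nonempty p (subst (0 <_) (sym ∣p∣≡1+k) z<s)

∣p∩q∣+∣p─q∣≡∣p∣ : (p q : Subset n) → ∣ p ∩ q ∣ + ∣ p ─ q ∣ ≡ ∣ p ∣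
∣p∩q∣+∣p─q∣≡∣p∣ p q = venn-≡ (p ∷ q ∷ []) [] (v0 & v1 ∷ v0 ∖ v1 ∷ []) (v0 ∷ []) []

∣p∩q∣≡m⇒∣p─q∣≡k : ∀ {k m} (p q : Subset n) → ∣ p ∣ ≡ k + m → ∣ p ∩ q ∣ ≡ m → ∣ p ─ q ∣ ≡ k
∣p∩q∣≡m⇒∣p─q∣≡k {k = k} {m} p q ∣p∣≡k+m ∣p∩q∣≡m = +-cancelʳ-≡ m ∣ p ─ q ∣ k (begin
  ∣ p ─ q ∣ + m         ≡⟨ cong (∣ p ─ q ∣ +_) ∣p∩q∣≡m ⟨
  ∣ p ─ q ∣ + ∣ p ∩ q ∣ ≡⟨ +-comm ∣ p ─ q ∣ ∣ p ∩ q ∣ ⟩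
  ∣ p ∩ q ∣ + ∣ p ─ q ∣ ≡⟨ ∣p∩q∣+∣p─q∣≡∣p∣ p q ⟩
  ∣ p ∣                 ≡⟨ ∣p∣≡k+m ⟩
  k + m                 ∎)
  where open ≡-Reasoning

∣p∪q∣+∣p∩q∣≡∣p∣+∣q∣ : (p q : Subset n) → ∣ p ∪ q ∣ + ∣ p ∩ q ∣ ≡ ∣ p ∣ + ∣ q ∣
∣p∪q∣+∣p∩q∣≡∣p∣+∣q∣ p q = venn-≡ (p ∷ q ∷ []) [] (v0 ∥ v1 ∷ v0 & v1 ∷ []) (v0 ∷ v1 ∷ []) []

∣p─q∣≡0⇒p⊆q : (p q : Subset n) → ∣ p ─ q ∣ ≡ 0 → p ⊆ q
∣p─q∣≡0⇒p⊆q p q ∣p─q∣≡0 = venn-⊆ (p ∷ q ∷ []) (v0 ∖ v1 ⊑ ∅ ∷ []) (v0 ⊑ v1) (∣p∣≡0⇒p⊆⊥ ∣p─q∣≡0 ∷ [])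

∣p∣≤∣p∩q∣⇒p⊆q : (p q : Subset n) → ∣ p ∣ ≤ ∣ p ∩ q ∣ → p ⊆ q
∣p∣≤∣p∩q∣⇒p⊆q p q ∣p∣≤∣p∩q∣ = ∣p─q∣≡0⇒p⊆q p q (n≤0⇒n≡0 (+-cancelˡ-≤ ∣ p ∩ q ∣ _ 0 (begin
  ∣ p ∩ q ∣ + ∣ p ─ q ∣ ≡⟨ ∣p∩q∣+∣p─q∣≡∣p∣ p q ⟩
  ∣ p ∣                 ≤⟨ ∣p∣≤∣p∩q∣ ⟩
  ∣ p ∩ q ∣             ≡⟨ +-identityʳ _ ⟨
  ∣ p ∩ q ∣ + 0         ∎)))
  where open ≤-Reasoning

∣p∩q∣<∣p∣⇒p─q-nonempty : (p q : Subset n) → ∣ p ∩ q ∣ < ∣ p ∣ → Nonempty (p ─ q)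
∣p∩q∣<∣p∣⇒p─q-nonempty p q lt = 0<∣p∣⇒nonempty (p ─ q) (+-cancelˡ-< ∣ p ∩ q ∣ 0 _ (begin-strict
  ∣ p ∩ q ∣ + 0         ≡⟨ +-identityʳ _ ⟩
  ∣ p ∩ q ∣             <⟨ lt ⟩
  ∣ p ∣                 ≡⟨ ∣p∩q∣+∣p─q∣≡∣p∣ p q ⟨
  ∣ p ∩ q ∣ + ∣ p ─ q ∣ ∎))
  where open ≤-Reasoning

≢⇒∣p∩q∣< : ∀ {p q : Subset n} {c} → ∣ p ∣ ≡ c → ∣ q ∣ ≡ c → p ≢ q → ∣ p ∩ q ∣ < c
≢⇒∣p∩q∣< {p = p} {q} {c} ∣p∣≡c ∣q∣≡c p≢q with ∣ p ∩ q ∣ <? c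
... | yes lt = lt
... | no ≮  = contradiction (⊆-antisym p⊆q q⊆p) p≢q
  where
  p⊆q : p ⊆ q
  p⊆q = ∣p∣≤∣p∩q∣⇒p⊆q p q (subst (_≤ _) (sym ∣p∣≡c) (≮⇒≥ ≮))
  q⊆p : q ⊆ p
  q⊆p = ∣p∣≤∣p∩q∣⇒p⊆q q p (subst₂ _≤_ (sym ∣q∣≡c) (cong ∣_∣ (∩-comm p q)) (≮⇒≥ ≮))

1+∣p-x∣≡∣p∣ : ∀ {x} (p : Subset n) → x ∈ₛ p → 1 + ∣ p - x ∣ ≡ ∣ p ∣
1+∣p-x∣≡∣p∣ {x = x} p x∈p = begin
  1 + ∣ p - x ∣         ≡⟨ cong (_+ ∣ p - x ∣) (∣⁅x⁆∣≡1 x) ⟨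
  ∣ ⁅ x ⁆ ∣ + ∣ p - x ∣ ≡⟨ venn-≡ (p ∷ ⁅ x ⁆ ∷ []) (v1 ⊑ v0 ∷ []) (v1 ∷ v0 ∖ v1 ∷ []) (v0 ∷ [])
                                 (x∈p⇒⁅x⁆⊆p x∈p ∷ []) ⟩
  ∣ p ∣                 ∎
  where open ≡-Reasoning

∣p-x∣≡k : ∀ {x k} (p : Subset n) → x ∈ₛ p → ∣ p ∣ ≡ suc k → ∣ p - x ∣ ≡ k
∣p-x∣≡k p x∈p ∣p∣≡1+k = suc-injective (trans (1+∣p-x∣≡∣p∣ p x∈p) ∣p∣≡1+k)

∣p∣≡1⇒p≡⁅x⁆ : ∀ {x} (p : Subset n) → ∣ p ∣ ≡ 1 → x ∈ₛ p → p ≡ ⁅ x ⁆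
∣p∣≡1⇒p≡⁅x⁆ {x = x} p ∣p∣≡1 x∈p = ⊆-antisym p⊆⁅x⁆ (x∈p⇒⁅x⁆⊆p x∈p)
  where
  p-x⊆⊥ : p - x ⊆ ⊥
  p-x⊆⊥ = ∣p∣≡0⇒p⊆⊥ (∣p-x∣≡k p x∈p ∣p∣≡1)
  p⊆⁅x⁆ : p ⊆ ⁅ x ⁆
  p⊆⁅x⁆ = venn-⊆ (p ∷ ⁅ x ⁆ ∷ []) (v0 ∖ v1 ⊑ ∅ ∷ []) (v0 ⊑ v1) (p-x⊆⊥ ∷ [])

∣p∣≡1⇒singleton : (p : Subset n) → ∣ p ∣ ≡ 1 → ∃ λ x → p ≡ ⁅ x ⁆
∣p∣≡1⇒singleton p ∣p∣≡1 with ∣p∣≡1+k⇒nonempty p ∣p∣≡1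
... | x , x∈p = x , ∣p∣≡1⇒p≡⁅x⁆ p ∣p∣≡1 x∈p

∣p∩q∣≡∣q∣ : (p q : Subset n) → q ⊆ p → ∣ p ∩ q ∣ ≡ ∣ q ∣
∣p∩q∣≡∣q∣ p q q⊆p = venn-≡ (p ∷ q ∷ []) (v1 ⊑ v0 ∷ []) (v0 & v1 ∷ []) (v1 ∷ []) (q⊆p ∷ [])

p∪q≡[p─q]∪q : (p q : Subset n) → p ∪ q ≡ (p ─ q) ∪ q
p∪q≡[p─q]∪q p q = ⊆-antisym (venn-⊆ (p ∷ q ∷ []) [] (v0 ∥ v1 ⊑ (v0 ∖ v1) ∥ v1) [])
                            (venn-⊆ (p ∷ q ∷ []) [] ((v0 ∖ v1) ∥ v1 ⊑ v0 ∥ v1) [])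

⊈⇒∣p∩q∣<∣p∣ : (p q : Subset n) → ¬ (p ⊆ q) → ∣ p ∩ q ∣ < ∣ p ∣
⊈⇒∣p∩q∣<∣p∣ p q p⊈q = ≰⇒> (p⊈q ∘ ∣p∣≤∣p∩q∣⇒p⊆q p q)

x∉p⇒∣p∪⁅x⁆∣≡1+∣p∣ : ∀ {x} (p : Subset n) → x ∉ₛ p → ∣ p ∪ ⁅ x ⁆ ∣ ≡ 1 + ∣ p ∣
x∉p⇒∣p∪⁅x⁆∣≡1+∣p∣ {x = x} p x∉p = begin
  ∣ p ∪ ⁅ x ⁆ ∣         ≡⟨ venn-≡ (p ∷ ⁅ x ⁆ ∷ []) (v1 ⊑ ~ v0 ∷ []) (v0 ∥ v1 ∷ []) (v1 ∷ v0 ∷ [])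
                                 (x∉p⇒⁅x⁆⊆∁p x∉p ∷ []) ⟩
  ∣ ⁅ x ⁆ ∣ + ∣ p ∣     ≡⟨ cong (_+ ∣ p ∣) (∣⁅x⁆∣≡1 x) ⟩
  1 + ∣ p ∣             ∎
  where open ≡-Reasoning

p─q≡⁅x⁆⇒q∩p≡p-x : ∀ {x} (p q : Subset n) → p ─ q ≡ ⁅ x ⁆ → q ∩ p ≡ p - x
p─q≡⁅x⁆⇒q∩p≡p-x {x = x} p q p─q≡⁅x⁆ =
  ⊆-antisym (venn-⊆ ρ hs (v1 & v0 ⊑ v0 ∖ v2) hs-hold) (venn-⊆ ρ hs (v0 ∖ v2 ⊑ v1 & v0) hs-hold)
  where
  ρ = p ∷ q ∷ ⁅ x ⁆ ∷ []
  hs = v0 ∖ v1 ⊑ v2 ∷ v2 ⊑ v0 ∖ v1 ∷ []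
  hs-hold = ⊆-reflexive p─q≡⁅x⁆ ∷ ⊆-reflexive (sym p─q≡⁅x⁆) ∷ []

∣p∣≡2⇒two-points : (p : Subset n) → ∣ p ∣ ≡ 2 →
                   ∃₂ λ a b → a ∈ₛ p × b ∈ₛ p × (∀ {z} → z ∈ₛ p → z ≡ a ⊎ z ≡ b)
∣p∣≡2⇒two-points p ∣p∣≡2 with ∣p∣≡1+k⇒nonempty p ∣p∣≡2
... | a , a∈p with ∣p∣≡1+k⇒nonempty (p - a) (∣p-x∣≡k p a∈p ∣p∣≡2)
... | b , b∈p-a = a , b , a∈p , p─q⊆p p ⁅ a ⁆ b∈p-a , a-or-b
  where
  a-or-b : ∀ {z} → z ∈ₛ p → z ≡ a ⊎ z ≡ b
  a-or-b {z} z∈p with z ≟ a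
  ... | yes z≡a = inj₁ z≡a
  ... | no z≢a  = inj₂ (x∈⁅y⁆⇒x≡y b (subst (z ∈ₛ_) p-a≡⁅b⁆ (x∈p∧x≢y⇒x∈p-y z∈p z≢a)))
    where p-a≡⁅b⁆ = ∣p∣≡1⇒p≡⁅x⁆ (p - a) (∣p-x∣≡k p a∈p ∣p∣≡2) b∈p-a

p⊆r∧q⊆r⇒p∪q⊆r : {p q r : Subset n} → p ⊆ r → q ⊆ r → p ∪ q ⊆ r
p⊆r∧q⊆r⇒p∪q⊆r {p = p} {q} {r} p⊆r q⊆r =
  venn-⊆ (p ∷ q ∷ r ∷ []) (v0 ⊑ v2 ∷ v1 ⊑ v2 ∷ []) (v0 ∥ v1 ⊑ v2) (p⊆r ∷ q⊆r ∷ [])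

x∈p─q⇒x∉q : ∀ {x} {p q : Subset n} → x ∈ₛ p ─ q → x ∉ₛ q
x∈p─q⇒x∉q {p = p} {q} x∈p─q = x∈∁p⇒x∉p (venn-⊆ (p ∷ q ∷ []) [] (v0 ∖ v1 ⊑ ~ v1) [] x∈p─q)

record Cover (m : ℕ) (P : Subset n → Set) (b : ℕ) : Set where
  constructor cover
  field
    sets    : List (Subset n)
    length≤ : length sets ≤ b
    sizes   : All (λ c → ∣ c ∣ ≡ m) sets
    covers  : ∀ {f} → P f → ∃[ c ] c ∈ sets × c ⊆ f

module _ {m : ℕ} {P Q R : Subset n → Set} where

  cover-∪ : ∀ {a b} → Cover m P a → Cover m Q b → (∀ {f} → R f → P f ⊎ Q f) → Cover m R (a + b)
  cover-∪ {a} {b} (cover L₁ ∣L₁∣≤a L₁-sizes L₁-covers) (cover L₂ ∣L₂∣≤b L₂-sizes L₂-covers) split =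
    cover (L₁ ++ L₂) (subst (_≤ a + b) (sym (length-++ L₁)) (+-mono-≤ ∣L₁∣≤a ∣L₂∣≤b))
          (++⁺ L₁-sizes L₂-sizes) covers
    where
    covers : ∀ {f} → R f → ∃[ c ] c ∈ L₁ ++ L₂ × c ⊆ f
    covers Rf with split Rf
    ... | inj₁ Pf = let c , c∈L₁ , c⊆f = L₁-covers Pf in c , ∈-++⁺ˡ c∈L₁ , c⊆f
    ... | inj₂ Qf = let c , c∈L₂ , c⊆f = L₂-covers Qf in c , ∈-++⁺ʳ L₁ c∈L₂ , c⊆f

cover-⊎ : ∀ {m a b} {P Q : Subset n → Set} → Cover m P a → Cover m Q b → Cover m (λ f → P f ⊎ Q f) (a + b)
cover-⊎ A B = cover-∪ A B id

cover-mono : ∀ {m b} {P Q : Subset n → Set} → (∀ {f} → Q f → P f) → Cover m P b → Cover m Q b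
cover-mono Q⇒P (cover L ∣L∣≤b sizes covers) = cover L ∣L∣≤b sizes (covers ∘ Q⇒P)

cover-weaken : ∀ {m a b} {P : Subset n → Set} → a ≤ b → Cover m P a → Cover m P b
cover-weaken a≤b (cover L ∣L∣≤a sizes covers) = cover L (≤-trans ∣L∣≤a a≤b) sizes covers

singleton-cover : ∀ {m} {P : Subset n → Set} (S : Subset n) → ∣ S ∣ ≡ m → (∀ {f} → P f → S ⊆ f) → Cover m P 1
singleton-cover S ∣S∣≡m S⊆ = cover (S ∷ []) ≤-refl (∣S∣≡m ∷ []) (λ Pf → S , here refl , S⊆ Pf)

module PairCover {m : ℕ} (T : Subset n) (∣T∣≡2+m : ∣ T ∣ ≡ 2 + m) where

  ∣T-x-y∣≡m : ∀ {x y} → x ∈ₛ T → y ∈ₛ T - x → ∣ T - x - y ∣ ≡ m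
  ∣T-x-y∣≡m {x} {y} x∈T y∈T-x =
    ∣p-x∣≡k (T - x) y∈T-x (∣p-x∣≡k T x∈T ∣T∣≡2+m)

  T-x-y⊆T-x : ∀ x y → T - x - y ⊆ T - x
  T-x-y⊆T-x x y = p─q⊆p (T - x) ⁅ y ⁆

  T-x-y⊆T-y : ∀ x y → T - x - y ⊆ T - y
  T-x-y⊆T-y x y = subst (_⊆ T - y) (p─x─y≡p─y─x T y x) (T-x-y⊆T-x y x)

  pairing : ∀ r {R} → ∣ R ∣ ≡ r → R ⊆ T → Cover m (λ f → ∃[ x ] x ∈ₛ R × T - x ⊆ f) ⌈ r /2⌉
  pairing zero ∣R∣≡0 _ = cover [] z≤n [] (λ (x , x∈R , _) → contradiction (∣p∣≡0⇒p⊆⊥ ∣R∣≡0 x∈R) ∉⊥)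
  pairing (suc zero) {R} ∣R∣≡1 R⊆T with ∣p∣≡1+k⇒nonempty R ∣R∣≡1
  ... | x , x∈R with ∣p∣≡1+k⇒nonempty (T - x) (∣p-x∣≡k T (R⊆T x∈R) ∣T∣≡2+m)
  ... | y , y∈T-x = singleton-cover (T - x - y) (∣T-x-y∣≡m (R⊆T x∈R) y∈T-x) covers
    where
    covers : ∀ {f} → ∃[ z ] z ∈ₛ R × T - z ⊆ f → T - x - y ⊆ f
    covers (z , z∈R , T-z⊆f) rewrite x∈⁅y⁆⇒x≡y x (subst (z ∈ₛ_) (∣p∣≡1⇒p≡⁅x⁆ R ∣R∣≡1 x∈R) z∈R) =
      ⊆-trans (T-x-y⊆T-x x y) T-z⊆f
  pairing (suc (suc r)) {R} ∣R∣≡2+r R⊆T with ∣p∣≡1+k⇒nonempty R ∣R∣≡2+r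
  ... | x , x∈R with ∣p∣≡1+k⇒nonempty (R - x) (∣p-x∣≡k R x∈R ∣R∣≡2+r)
  ... | y , y∈R-x =
    cover-∪ (singleton-cover (T - x - y) (∣T-x-y∣≡m (R⊆T x∈R) y∈T-x) id) (pairing r ∣R'∣≡r R'⊆T) split
    where
    y∈T-x : y ∈ₛ T - x
    y∈T-x = venn-⊆ (R ∷ T ∷ ⁅ x ⁆ ∷ []) (v0 ⊑ v1 ∷ []) (v0 ∖ v2 ⊑ v1 ∖ v2) (R⊆T ∷ []) y∈R-x
    ∣R'∣≡r : ∣ R - x - y ∣ ≡ r
    ∣R'∣≡r = ∣p-x∣≡k (R - x) y∈R-x (∣p-x∣≡k R x∈R ∣R∣≡2+r)
    R'⊆T : R - x - y ⊆ T
    R'⊆T = ⊆-trans (p─q⊆p (R - x) ⁅ y ⁆) (⊆-trans (p─q⊆p R ⁅ x ⁆) R⊆T)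
    split : ∀ {f} → ∃[ z ] z ∈ₛ R × T - z ⊆ f → T - x - y ⊆ f ⊎ ∃[ z ] z ∈ₛ R - x - y × T - z ⊆ f
    split (z , z∈R , T-z⊆f) with z ≟ x | z ≟ y
    ... | yes refl | _        = inj₁ (⊆-trans (T-x-y⊆T-x x y) T-z⊆f)
    ... | no _     | yes refl = inj₁ (⊆-trans (T-x-y⊆T-y x y) T-z⊆f)
    ... | no z≢x   | no z≢y   = inj₂ (z , x∈p∧x≢y⇒x∈p-y (x∈p∧x≢y⇒x∈p-y z∈R z≢x) z≢y , T-z⊆f)

  pair-cover : Cover m (λ f → ∣ f ∣ ≡ 1 + m × f ⊆ T) ⌈ 2 + m /2⌉
  pair-cover = cover-mono missing-point (pairing (2 + m) ∣T∣≡2+m ⊆-refl)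
    where
    missing-point : ∀ {f} → ∣ f ∣ ≡ 1 + m × f ⊆ T → ∃[ x ] x ∈ₛ T × T - x ⊆ f
    missing-point {f} (∣f∣≡1+m , f⊆T) with ∣p∣≡1⇒singleton (T ─ f) ∣T─f∣≡1
      where ∣T─f∣≡1 = ∣p∩q∣≡m⇒∣p─q∣≡k T f ∣T∣≡2+m (trans (∣p∩q∣≡∣q∣ T f f⊆T) ∣f∣≡1+m)
    ... | x , T─f≡⁅x⁆ = x , x∈T , T-x⊆f
      where
      x∈T = p─q⊆p T f (subst (x ∈ₛ_) (sym T─f≡⁅x⁆) (x∈⁅x⁆ x))
      T-x⊆f = venn-⊆ (T ∷ f ∷ ⁅ x ⁆ ∷ []) (v0 ∖ v1 ⊑ v2 ∷ []) (v0 ∖ v2 ⊑ v1) (⊆-reflexive T─f≡⁅x⁆ ∷ [])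

_≟ₛ_ : (p q : Subset n) → Dec (p ≡ q)
_≟ₛ_ = ≡-dec Bool._≟_

module Clique {m : ℕ} (F : List (Subset n)) (∣F∣≡1+m : ∀ {f} → f ∈ F → ∣ f ∣ ≡ 1 + m)
              (m≤∣f∩g∣ : ∀ {f g} → f ∈ F → g ∈ F → m ≤ ∣ f ∩ g ∣) {e : Subset n} (e∈F : e ∈ F) where

  ∣f∩e∣≡m : ∀ {f} → f ∈ F → f ≢ e → ∣ f ∩ e ∣ ≡ m
  ∣f∩e∣≡m f∈F f≢e = ≤-antisym (≤-pred (≢⇒∣p∩q∣< (∣F∣≡1+m f∈F) (∣F∣≡1+m e∈F) f≢e)) (m≤∣f∩g∣ f∈F e∈F)

  ∣f─e∣≡1 : ∀ {f} → f ∈ F → f ≢ e → ∣ f ─ e ∣ ≡ 1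
  ∣f─e∣≡1 {f} f∈F f≢e = ∣p∩q∣≡m⇒∣p─q∣≡k f e (∣F∣≡1+m f∈F) (∣f∩e∣≡m f∈F f≢e)

  ∣f∪e∣≡2+m : ∀ {f} → f ∈ F → f ≢ e → ∣ f ∪ e ∣ ≡ 2 + m
  ∣f∪e∣≡2+m {f} f∈F f≢e = +-cancelʳ-≡ m _ (2 + m) (begin
    ∣ f ∪ e ∣ + m         ≡⟨ cong (∣ f ∪ e ∣ +_) (∣f∩e∣≡m f∈F f≢e) ⟨
    ∣ f ∪ e ∣ + ∣ f ∩ e ∣ ≡⟨ ∣p∪q∣+∣p∩q∣≡∣p∣+∣q∣ f e ⟩
    ∣ f ∣ + ∣ e ∣         ≡⟨ cong₂ _+_ (∣F∣≡1+m f∈F) (∣F∣≡1+m e∈F) ⟩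
    (1 + m) + (1 + m)     ≡⟨ cong suc (+-suc m m) ⟩
    (2 + m) + m           ∎)
    where open ≡-Reasoning

  meet-outside-e : ∀ {f g} → f ∈ F → g ∈ F → f ≢ e → g ≢ e → f ∩ e ≢ g ∩ e → Nonempty (f ∩ g ─ e)
  meet-outside-e {f} {g} f∈F g∈F f≢e g≢e f∩e≢g∩e = ∣p∩q∣<∣p∣⇒p─q-nonempty (f ∩ g) e (begin-strict
    ∣ (f ∩ g) ∩ e ∣       ≡⟨ venn-≡ (f ∷ g ∷ e ∷ []) [] ((v0 & v1) & v2 ∷ []) ((v0 & v2) & (v1 & v2) ∷ []) [] ⟩
    ∣ (f ∩ e) ∩ (g ∩ e) ∣ <⟨ ≢⇒∣p∩q∣< (∣f∩e∣≡m f∈F f≢e) (∣f∩e∣≡m g∈F g≢e) f∩e≢g∩e ⟩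
    m                     ≤⟨ m≤∣f∩g∣ f∈F g∈F ⟩
    ∣ f ∩ g ∣             ∎)
    where open ≤-Reasoning

  ∪e-unique : ∀ {f g} → f ∈ F → g ∈ F → f ≢ e → g ≢ e → f ∩ e ≢ g ∩ e → f ∪ e ≡ g ∪ e
  ∪e-unique {f} {g} f∈F g∈F f≢e g≢e f∩e≢g∩e with meet-outside-e f∈F g∈F f≢e g≢e f∩e≢g∩e
  ... | z , z∈f∩g─e = begin
    f ∪ e           ≡⟨ p∪q≡[p─q]∪q f e ⟩
    (f ─ e) ∪ e     ≡⟨ cong (_∪ e) (∣p∣≡1⇒p≡⁅x⁆ (f ─ e) (∣f─e∣≡1 f∈F f≢e) z∈f─e) ⟩
    ⁅ z ⁆ ∪ e       ≡⟨ cong (_∪ e) (∣p∣≡1⇒p≡⁅x⁆ (g ─ e) (∣f─e∣≡1 g∈F g≢e) z∈g─e) ⟨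
    (g ─ e) ∪ e     ≡⟨ p∪q≡[p─q]∪q g e ⟨
    g ∪ e           ∎
    where
    open ≡-Reasoning
    z∈f─e = venn-⊆ (f ∷ g ∷ e ∷ []) [] ((v0 & v1) ∖ v2 ⊑ v0 ∖ v2) [] z∈f∩g─e
    z∈g─e = venn-⊆ (f ∷ g ∷ e ∷ []) [] ((v0 & v1) ∖ v2 ⊑ v1 ∖ v2) [] z∈f∩g─e

  record Spread : Set where
    field
      w₁ w₂     : Subset n
      w₁∈F      : w₁ ∈ F
      w₂∈F      : w₂ ∈ F
      w₁≢e      : w₁ ≢ e
      w₂≢e      : w₂ ≢ e
      w₁∩e≢w₂∩e : w₁ ∩ e ≢ w₂ ∩ e

    span : Subset n
    span = w₁ ∪ e

    ∣span∣≡2+m : ∣ span ∣ ≡ 2 + m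
    ∣span∣≡2+m = ∣f∪e∣≡2+m w₁∈F w₁≢e

    ∪e≡span : ∀ {f} → f ∈ F → f ≢ e → f ∪ e ≡ span
    ∪e≡span {f} f∈F f≢e with (f ∩ e) ≟ₛ (w₁ ∩ e)
    ... | no f∩e≢w₁∩e = ∪e-unique f∈F w₁∈F f≢e w₁≢e f∩e≢w₁∩e
    ... | yes f∩e≡w₁∩e =
      trans (∪e-unique f∈F w₂∈F f≢e w₂≢e (w₁∩e≢w₂∩e ∘ trans (sym f∩e≡w₁∩e)))
            (sym (∪e-unique w₁∈F w₂∈F w₁≢e w₂≢e w₁∩e≢w₂∩e))

    ⊆span : ∀ {f} → f ∈ F → f ⊆ span
    ⊆span {f} f∈F with f ≟ₛ e
    ... | yes refl = q⊆p∪q w₁ f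
    ... | no f≢e   = subst (f ⊆_) (∪e≡span f∈F f≢e) (p⊆p∪q e)

  data Shape : Set where
    sunflower : (S : Subset n) → ∣ S ∣ ≡ m → (∀ {f} → f ∈ F → S ⊆ f) → Shape
    spread    : Spread → Shape

  shape : Shape
  shape with any? (λ f → any? (λ g → ¬? (f ≟ₛ e) ×-dec ¬? (g ≟ₛ e) ×-dec ¬? ((f ∩ e) ≟ₛ (g ∩ e))) F) F
  ... | yes ∃differ with find ∃differ
  ...   | f , f∈F , ∃g with find ∃g
  ...     | g , g∈F , f≢e , g≢e , f∩e≢g∩e = spread (record
    { w₁ = f ; w₂ = g ; w₁∈F = f∈F ; w₂∈F = g∈F ; w₁≢e = f≢e ; w₂≢e = g≢e ; w₁∩e≢w₂∩e = f∩e≢g∩e })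
  shape | no ∄differ with any? (λ f → ¬? (f ≟ₛ e)) F
  ... | yes ∃other with find ∃other
  ...   | f , f∈F , f≢e = sunflower (f ∩ e) (∣f∩e∣≡m f∈F f≢e) f∩e⊆
    where
    f∩e⊆ : ∀ {g} → g ∈ F → f ∩ e ⊆ g
    f∩e⊆ {g} g∈F with g ≟ₛ e
    ... | yes refl = p∩q⊆q f g
    ... | no g≢e   = subst (_⊆ g) (decidable-stable ((g ∩ e) ≟ₛ (f ∩ e)) g∩e≡f∩e) (p∩q⊆p g e)
      where
      g∩e≡f∩e : ¬ (g ∩ e) ≢ (f ∩ e)
      g∩e≡f∩e g∩e≢f∩e = ∄differ (lose g∈F (lose f∈F (g≢e , f≢e , g∩e≢f∩e)))
  shape | no ∄differ | no ∄other with ∣p∣≡1+k⇒nonempty e (∣F∣≡1+m e∈F)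
  ...   | x , x∈e = sunflower (e - x) ∣e-x∣≡m e-x⊆
    where
    ∣e-x∣≡m : ∣ e - x ∣ ≡ m
    ∣e-x∣≡m = ∣p-x∣≡k e x∈e (∣F∣≡1+m e∈F)
    e-x⊆ : ∀ {g} → g ∈ F → e - x ⊆ g
    e-x⊆ {g} g∈F with g ≟ₛ e
    ... | yes refl = p─q⊆p g ⁅ x ⁆
    ... | no g≢e   = contradiction (lose g∈F g≢e) ∄other

  clique-cover : Cover m (_∈ F) ⌈ 2 + m /2⌉
  clique-cover with shape
  ... | sunflower S ∣S∣≡m S⊆ = cover-weaken (s≤s z≤n) (singleton-cover S ∣S∣≡m S⊆)
  ... | spread sp = cover-mono (λ f∈F → ∣F∣≡1+m f∈F , λ {x} → ⊆span f∈F {x}) (PairCover.pair-cover span ∣span∣≡2+m)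
    where open Spread sp

-- The uniformity is written k = 3 + j, so (k-1)-sets are (2 + j)-sets and half = ⌈(k+1)/2⌉.
module TwoMatching {n j : ℕ} (H : Hypergraph n (3 + j))
                   (ν≤2 : ∀ M → IsMatching (2 + j) H M → length M ≤ 2) where

  E : List (Subset n)
  E = edges H

  ∣e∣≡3+j : ∀ {e} → e ∈ E → ∣ e ∣ ≡ 3 + j
  ∣e∣≡3+j = All.lookup (uniform H)

  Apart : Subset n → Subset n → Set
  Apart f g = ∣ f ∩ g ∣ < 2 + j

  apart? : ∀ f g → Dec (Apart f g)
  apart? f g = ∣ f ∩ g ∣ <? 2 + j

  apart⇒≢ : ∀ {f g} → f ∈ E → Apart f g → f ≢ g
  apart⇒≢ {f} f∈E f-apart-g refl =
    <⇒≱ f-apart-g (subst (2 + j ≤_) (sym (trans (cong ∣_∣ (∩-idem f)) (∣e∣≡3+j f∈E))) (n≤1+n _))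

  no-three-apart : ∀ {f g h} → f ∈ E → g ∈ E → h ∈ E → Apart f g → Apart f h → Apart g h → Data.Empty.⊥
  no-three-apart f∈E g∈E h∈E fg fh gh with ν≤2 (_ ∷ _ ∷ _ ∷ [])
    ((f∈E ∷ g∈E ∷ h∈E ∷ []) ,
     (((apart⇒≢ f∈E fg , fg) ∷ (apart⇒≢ f∈E fh , fh) ∷ []) ∷ ((apart⇒≢ g∈E gh , gh) ∷ []) ∷ [] ∷ []))
  ... | s≤s (s≤s ())

  apart-sym : ∀ {f g} → Apart f g → Apart g f
  apart-sym {f} {g} = subst (_< 2 + j) (cong ∣_∣ (∩-comm f g))

  apartFrom : Subset n → List (Subset n)
  apartFrom e = filter (λ f → apart? f e) E

  ∈apartFrom⁺ : ∀ {e f} → f ∈ E → Apart f e → f ∈ apartFrom e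
  ∈apartFrom⁺ {e} = ∈-filter⁺ (λ f → apart? f e)

  ∈apartFrom⁻ : ∀ {e f} → f ∈ apartFrom e → f ∈ E × Apart f e
  ∈apartFrom⁻ {e} = ∈-filter⁻ (λ f → apart? f e) {xs = E}

  apartFrom-pairwise : ∀ {e f g} → e ∈ E → f ∈ apartFrom e → g ∈ apartFrom e → 2 + j ≤ ∣ f ∩ g ∣
  apartFrom-pairwise e∈E f∈ g∈ with ∈apartFrom⁻ f∈ | ∈apartFrom⁻ g∈
  ... | f∈E , fe | g∈E , ge = ≮⇒≥ (λ fg → no-three-apart f∈E g∈E e∈E fg fe ge)

  module ApartFrom {e b : Subset n} (e∈E : e ∈ E) (b∈E : b ∈ E) (b-apart-e : Apart b e) =
    Clique (apartFrom e) (∣e∣≡3+j ∘ proj₁ ∘ ∈apartFrom⁻) (apartFrom-pairwise e∈E) (∈apartFrom⁺ b∈E b-apart-e)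

  half : ℕ
  half = ⌈ 4 + j /2⌉

  4≤half+half : 4 ≤ half + half
  4≤half+half = +-mono-≤ (s≤s (s≤s z≤n)) (s≤s (s≤s z≤n))

  half+2≤half+half : half + 2 ≤ half + half
  half+2≤half+half = +-monoʳ-≤ half (s≤s (s≤s z≤n))

  [3+j]+[1+j]≡[2+j]+[2+j] : (3 + j) + (1 + j) ≡ (2 + j) + (2 + j)
  [3+j]+[1+j]≡[2+j]+[2+j] = rearrange j
    where
    rearrange : ∀ j → (3 + j) + (1 + j) ≡ (2 + j) + (2 + j)
    rearrange = solve-∀

  adjacent-to-both⇒1+j≤∣f∩x∩y∣ : ∀ {f x y} → f ∈ E → ¬ Apart f x → ¬ Apart f y → 1 + j ≤ ∣ f ∩ (x ∩ y) ∣
  adjacent-to-both⇒1+j≤∣f∩x∩y∣ {f} {x} {y} f∈E ¬fx ¬fy = +-cancelˡ-≤ (3 + j) (1 + j) ∣ f ∩ (x ∩ y) ∣ (begin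
    (3 + j) + (1 + j)         ≡⟨ [3+j]+[1+j]≡[2+j]+[2+j] ⟩
    (2 + j) + (2 + j)         ≤⟨ +-mono-≤ (≮⇒≥ ¬fx) (≮⇒≥ ¬fy) ⟩
    ∣ f ∩ x ∣ + ∣ f ∩ y ∣     ≤⟨ venn-≤ (f ∷ x ∷ y ∷ []) []
                                       (v0 & v1 ∷ v0 & v2 ∷ []) (v0 ∷ v0 & (v1 & v2) ∷ []) [] ⟩
    ∣ f ∣ + ∣ f ∩ (x ∩ y) ∣   ≡⟨ cong (_+ ∣ f ∩ (x ∩ y) ∣) (∣e∣≡3+j f∈E) ⟩
    (3 + j) + ∣ f ∩ (x ∩ y) ∣ ∎)
    where open ≤-Reasoning

  far-pair-cover : ∀ {f₀ g₀} → f₀ ∈ E → g₀ ∈ E → ∣ f₀ ∩ g₀ ∣ ≤ j → Cover (2 + j) (_∈ E) (half + half)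
  far-pair-cover {f₀} {g₀} f₀∈E g₀∈E ∣f₀∩g₀∣≤j =
    cover-∪ (ApartFrom.clique-cover g₀∈E f₀∈E f₀-apart-g₀)
            (ApartFrom.clique-cover f₀∈E g₀∈E (apart-sym {f₀} f₀-apart-g₀)) split
    where
    f₀-apart-g₀ : Apart f₀ g₀
    f₀-apart-g₀ = s≤s (m≤n⇒m≤1+n ∣f₀∩g₀∣≤j)
    split : ∀ {f} → f ∈ E → f ∈ apartFrom g₀ ⊎ f ∈ apartFrom f₀
    split {f} f∈E with apart? f g₀ | apart? f f₀
    ... | yes fg₀ | _      = inj₁ (∈apartFrom⁺ f∈E fg₀)
    ... | no _    | yes ff₀ = inj₂ (∈apartFrom⁺ f∈E ff₀)
    ... | no ¬fg₀ | no ¬ff₀ = contradiction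
      (≤-trans (adjacent-to-both⇒1+j≤∣f∩x∩y∣ f∈E ¬ff₀ ¬fg₀) (∣p∩q∣≤∣q∣ f (f₀ ∩ g₀))) (<⇒≱ (s≤s ∣f₀∩g₀∣≤j))

  adjacent-to-both⇒x∩y⊆f : ∀ {f x y} → ∣ x ∩ y ∣ ≡ 1 + j → f ∈ E → ¬ Apart f x → ¬ Apart f y → x ∩ y ⊆ f
  adjacent-to-both⇒x∩y⊆f {f} {x} {y} ∣x∩y∣≡1+j f∈E ¬fx ¬fy = ∣p∣≤∣p∩q∣⇒p⊆q (x ∩ y) f (begin
    ∣ x ∩ y ∣       ≡⟨ ∣x∩y∣≡1+j ⟩
    1 + j           ≤⟨ adjacent-to-both⇒1+j≤∣f∩x∩y∣ f∈E ¬fx ¬fy ⟩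
    ∣ f ∩ (x ∩ y) ∣ ≡⟨ cong ∣_∣ (∩-comm f (x ∩ y)) ⟩
    ∣ (x ∩ y) ∩ f ∣ ∎)
    where open ≤-Reasoning

  ∣x∩y∪⁅z⁆∣≡2+j : ∀ {x y : Subset n} {z} → ∣ x ∩ y ∣ ≡ 1 + j → z ∈ₛ y ─ x → ∣ (x ∩ y) ∪ ⁅ z ⁆ ∣ ≡ 2 + j
  ∣x∩y∪⁅z⁆∣≡2+j {x} {y} ∣x∩y∣≡1+j z∈y─x = trans (x∉p⇒∣p∪⁅x⁆∣≡1+∣p∣ (x ∩ y) z∉x∩y) (cong suc ∣x∩y∣≡1+j)
    where z∉x∩y = x∈∁p⇒x∉p (venn-⊆ (x ∷ y ∷ []) [] (v1 ∖ v0 ⊑ ~ (v0 & v1)) [] z∈y─x)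

  -- y ─ x = {a, b}, and an edge through x ∩ y that is adjacent to y must pick up a or b.
  two-point-cover : ∀ {x y} → y ∈ E → ∣ x ∩ y ∣ ≡ 1 + j →
                    Cover (2 + j) (λ f → x ∩ y ⊆ f × ¬ Apart f y) 2
  two-point-cover {x} {y} y∈E ∣x∩y∣≡1+j with ∣p∣≡2⇒two-points (y ─ x) ∣y─x∣≡2
    where
    ∣y─x∣≡2 : ∣ y ─ x ∣ ≡ 2
    ∣y─x∣≡2 = ∣p∩q∣≡m⇒∣p─q∣≡k y x (∣e∣≡3+j y∈E) (trans (cong ∣_∣ (∩-comm y x)) ∣x∩y∣≡1+j)
  ... | a , b , a∈y─x , b∈y─x , a-or-b =
    cover ((x ∩ y) ∪ ⁅ a ⁆ ∷ (x ∩ y) ∪ ⁅ b ⁆ ∷ []) ≤-refl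
          (∣x∩y∪⁅z⁆∣≡2+j ∣x∩y∣≡1+j a∈y─x ∷ ∣x∩y∪⁅z⁆∣≡2+j ∣x∩y∣≡1+j b∈y─x ∷ []) covers
    where
    covers : ∀ {f} → x ∩ y ⊆ f × ¬ Apart f y → ∃[ c ] c ∈ (x ∩ y) ∪ ⁅ a ⁆ ∷ (x ∩ y) ∪ ⁅ b ⁆ ∷ [] × c ⊆ f
    covers {f} (C⊆f , ¬fy) with ∣p∩q∣<∣p∣⇒p─q-nonempty (f ∩ y) x ∣f∩y∩x∣<∣f∩y∣
      where
      ∣f∩y∩x∣<∣f∩y∣ : ∣ (f ∩ y) ∩ x ∣ < ∣ f ∩ y ∣
      ∣f∩y∩x∣<∣f∩y∣ = begin-strict
        ∣ (f ∩ y) ∩ x ∣ ≤⟨ venn-≤ (f ∷ x ∷ y ∷ []) [] ((v0 & v2) & v1 ∷ []) (v1 & v2 ∷ []) [] ⟩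
        ∣ x ∩ y ∣       ≡⟨ ∣x∩y∣≡1+j ⟩
        1 + j           <⟨ ≮⇒≥ ¬fy ⟩
        ∣ f ∩ y ∣       ∎
        where open ≤-Reasoning
    ... | z , z∈f∩y─x with a-or-b (venn-⊆ (f ∷ x ∷ y ∷ []) [] ((v0 & v2) ∖ v1 ⊑ v2 ∖ v1) [] z∈f∩y─x)
    ... | inj₁ refl = _ , here refl , p⊆r∧q⊆r⇒p∪q⊆r C⊆f (x∈p⇒⁅x⁆⊆p (p∩q⊆p f y (p─q⊆p (f ∩ y) x z∈f∩y─x)))
    ... | inj₂ refl = _ , there (here refl) , p⊆r∧q⊆r⇒p∪q⊆r C⊆f (x∈p⇒⁅x⁆⊆p (p∩q⊆p f y (p─q⊆p (f ∩ y) x z∈f∩y─x)))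

  cover-if-apart⇒⊇∩ : ∀ {x y} → x ∈ E → y ∈ E → Apart x y → ∣ x ∩ y ∣ ≡ 1 + j →
                   (∀ {f} → f ∈ E → Apart f x → x ∩ y ⊆ f) → Cover (2 + j) (_∈ E) (half + 2)
  cover-if-apart⇒⊇∩ {x} {y} x∈E y∈E x-apart-y ∣x∩y∣≡1+j apart⇒⊇∩ =
    cover-∪ (ApartFrom.clique-cover y∈E x∈E x-apart-y) (two-point-cover y∈E ∣x∩y∣≡1+j) split
    where
    split : ∀ {f} → f ∈ E → f ∈ apartFrom y ⊎ (x ∩ y ⊆ f × ¬ Apart f y)
    split {f} f∈E with apart? f y | apart? f x
    ... | yes fy | _      = inj₁ (∈apartFrom⁺ f∈E fy)
    ... | no ¬fy | yes fx = inj₂ (apart⇒⊇∩ f∈E fx , ¬fy)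
    ... | no ¬fy | no ¬fx = inj₂ (adjacent-to-both⇒x∩y⊆f ∣x∩y∣≡1+j f∈E ¬fx ¬fy , ¬fy)

  ⊆∪-by-count : ∀ {f x y} d → f ∈ E → (3 + j) + d ≤ ∣ f ∩ x ∣ + ∣ f ∩ y ∣ → ∣ f ∩ (x ∩ y) ∣ ≤ d → f ⊆ x ∪ y
  ⊆∪-by-count {f} {x} {y} d f∈E lower upper = ∣p∣≤∣p∩q∣⇒p⊆q f (x ∪ y) (begin
    ∣ f ∣           ≡⟨ ∣e∣≡3+j f∈E ⟩
    3 + j           ≤⟨ +-cancelʳ-≤ d (3 + j) ∣ f ∩ (x ∪ y) ∣ (begin
      (3 + j) + d                     ≤⟨ lower ⟩
      ∣ f ∩ x ∣ + ∣ f ∩ y ∣           ≡⟨ venn-≡ (f ∷ x ∷ y ∷ []) []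
                                             (v0 & v1 ∷ v0 & v2 ∷ []) (v0 & (v1 ∥ v2) ∷ v0 & (v1 & v2) ∷ []) [] ⟩
      ∣ f ∩ (x ∪ y) ∣ + ∣ f ∩ (x ∩ y) ∣ ≤⟨ +-monoʳ-≤ ∣ f ∩ (x ∪ y) ∣ upper ⟩
      ∣ f ∩ (x ∪ y) ∣ + d             ∎) ⟩
    ∣ f ∩ (x ∪ y) ∣ ∎)
    where open ≤-Reasoning

  -- f ∩ r lies in f ∩ (x ∪ y) minus a point of x ∩ y outside r.
  apart-from-missing : ∀ {x y r f} → r ⊆ x ∪ y → ¬ (x ∩ y ⊆ r) →
                       f ∈ E → x ∩ y ⊆ f → ¬ (f ⊆ x ∪ y) → Apart f r
  apart-from-missing {x} {y} {r} {f} r⊆U C⊈r f∈E C⊆f f⊈U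
    with ∣p∩q∣<∣p∣⇒p─q-nonempty (x ∩ y) r (⊈⇒∣p∩q∣<∣p∣ (x ∩ y) r C⊈r)
  ... | c , c∈C─r = +-cancelʳ-< 1 ∣ f ∩ r ∣ (2 + j) (begin-strict
    ∣ f ∩ r ∣ + 1         ≡⟨ cong (∣ f ∩ r ∣ +_) (∣⁅x⁆∣≡1 c) ⟨
    ∣ f ∩ r ∣ + ∣ ⁅ c ⁆ ∣ ≤⟨ venn-≤ (f ∷ r ∷ x ∷ y ∷ ⁅ c ⁆ ∷ [])
                                   (v1 ⊑ v2 ∥ v3 ∷ v4 ⊑ (v2 & v3) ∖ v1 ∷ v2 & v3 ⊑ v0 ∷ [])
                                   (v0 & v1 ∷ v4 ∷ []) (v0 & (v2 ∥ v3) ∷ [])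
                                   (r⊆U ∷ x∈p⇒⁅x⁆⊆p c∈C─r ∷ C⊆f ∷ []) ⟩
    ∣ f ∩ (x ∪ y) ∣       <⟨ ⊈⇒∣p∩q∣<∣p∣ f (x ∪ y) f⊈U ⟩
    ∣ f ∣                 ≡⟨ ∣e∣≡3+j f∈E ⟩
    3 + j                 ≡⟨ +-comm 1 (2 + j) ⟩
    (2 + j) + 1           ∎)
    where open ≤-Reasoning

  adjacent⇒∣f─g∣≤1 : ∀ {f g} → f ∈ E → ¬ Apart f g → ∣ f ─ g ∣ ≤ 1
  adjacent⇒∣f─g∣≤1 {f} {g} f∈E ¬fg = +-cancelˡ-≤ (2 + j) ∣ f ─ g ∣ 1 (begin
    (2 + j) + ∣ f ─ g ∣   ≤⟨ +-monoˡ-≤ ∣ f ─ g ∣ (≮⇒≥ ¬fg) ⟩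
    ∣ f ∩ g ∣ + ∣ f ─ g ∣ ≡⟨ ∣p∩q∣+∣p─q∣≡∣p∣ f g ⟩
    ∣ f ∣                 ≡⟨ ∣e∣≡3+j f∈E ⟩
    3 + j                 ≡⟨ +-comm 1 (2 + j) ⟩
    (2 + j) + 1           ∎)
    where open ≤-Reasoning

  ≢⇒0<∣f─g∣ : ∀ {f g} → f ∈ E → g ∈ E → f ≢ g → 0 < ∣ f ─ g ∣
  ≢⇒0<∣f─g∣ {f} {g} f∈E g∈E f≢g =
    x∈p⇒0<∣p∣ (proj₂ (∣p∩q∣<∣p∣⇒p─q-nonempty f g (subst (∣ f ∩ g ∣ <_) (sym (∣e∣≡3+j f∈E))
                                                      (≢⇒∣p∩q∣< (∣e∣≡3+j f∈E) (∣e∣≡3+j g∈E) f≢g))))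

  missed-point : ∀ {x w} → x ∈ E → ∣ w ∩ x ∣ ≡ 2 + j → ∃ λ a → x ─ w ≡ ⁅ a ⁆
  missed-point {x} {w} x∈E ∣w∩x∣≡2+j =
    ∣p∣≡1⇒singleton (x ─ w) (∣p∩q∣≡m⇒∣p─q∣≡k x w (∣e∣≡3+j x∈E) (trans (cong ∣_∣ (∩-comm x w)) ∣w∩x∣≡2+j))

  -- Inside p, h ∩ f avoids h ∩ (p ─ q) because f ∩ (p ─ q) = {u} and u ∉ h; outside p it lies in f ─ p.
  apart-via-private-point : ∀ {p q h f u} → q ∈ E → h ∈ E → f ∈ E → h ⊆ p ∪ q → f ⊆ p ∪ q →
                            Apart h p → h ≢ q → ¬ Apart f p → ¬ Apart f q →
                            u ∈ₛ p ─ q → u ∉ₛ h → u ∈ₛ f → Apart h f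
  apart-via-private-point {p} {q} {h} {f} {u} q∈E h∈E f∈E h⊆p∪q f⊆p∪q h-apart-p h≢q ¬fp ¬fq u∈p─q u∉h u∈f =
    ≤-<-trans (+-cancelʳ-≤ 2 ∣ h ∩ f ∣ ∣ h ∩ p ∣ (begin
      ∣ h ∩ f ∣ + 2                       ≤⟨ +-monoʳ-≤ ∣ h ∩ f ∣ (+-mono-≤ (≢⇒0<∣f─g∣ h∈E q∈E h≢q) ∣⁅u⁆∣≥1) ⟩
      ∣ h ∩ f ∣ + (∣ h ─ q ∣ + ∣ ⁅ u ⁆ ∣) ≤⟨ counting ⟩
      ∣ h ∩ p ∣ + (∣ f ─ q ∣ + ∣ f ─ p ∣) ≤⟨ +-monoʳ-≤ ∣ h ∩ p ∣ (+-mono-≤ (adjacent⇒∣f─g∣≤1 f∈E ¬fq)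
                                                                        (adjacent⇒∣f─g∣≤1 f∈E ¬fp)) ⟩
      ∣ h ∩ p ∣ + 2                       ∎))
      h-apart-p
    where
    open ≤-Reasoning
    ∣⁅u⁆∣≥1 = ≤-reflexive (sym (∣⁅x⁆∣≡1 u))
    counting : ∣ h ∩ f ∣ + (∣ h ─ q ∣ + ∣ ⁅ u ⁆ ∣) ≤ ∣ h ∩ p ∣ + (∣ f ─ q ∣ + ∣ f ─ p ∣)
    counting = venn-≤ (h ∷ f ∷ p ∷ q ∷ ⁅ u ⁆ ∷ [])
                 (v0 ⊑ v2 ∥ v3 ∷ v1 ⊑ v2 ∥ v3 ∷ v4 ⊑ v2 ∖ v3 ∷ v4 ⊑ ~ v0 ∷ v4 ⊑ v1 ∷ [])
                 (v0 & v1 ∷ v0 ∖ v3 ∷ v4 ∷ []) (v0 & v2 ∷ v1 ∖ v3 ∷ v1 ∖ v2 ∷ [])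
                 (h⊆p∪q ∷ f⊆p∪q ∷ x∈p⇒⁅x⁆⊆p u∈p─q ∷ x∉p⇒⁅x⁆⊆∁p u∉h ∷ x∈p⇒⁅x⁆⊆p u∈f ∷ [])

  -- Otherwise g ∪ q would fit into (p ∪ q) - a.
  missed-point-in-other : ∀ {p q g a} → q ∈ E → g ∈ E → g ⊆ p ∪ q → ∣ p ∪ q ∣ ≡ 5 + j → Apart g q →
                          a ∈ₛ p → a ∉ₛ g → a ∈ₛ q
  missed-point-in-other {p} {q} {g} {a} q∈E g∈E g⊆p∪q ∣p∪q∣≡5+j g-apart-q a∈p a∉g with a ∈? q
  ... | yes a∈q = a∈q
  ... | no a∉q  = ⊥-elim (<⇒≱ g-apart-q (+-cancelʳ-≤ (5 + j) (2 + j) ∣ g ∩ q ∣ (begin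
    (2 + j) + (5 + j)           ≡⟨ rearrange j ⟩
    (3 + j) + ((3 + j) + 1)     ≡⟨ cong₂ (λ s t → s + (t + 1)) (∣e∣≡3+j q∈E) (∣e∣≡3+j g∈E) ⟨
    ∣ q ∣ + (∣ g ∣ + 1)         ≡⟨ cong (λ t → ∣ q ∣ + (∣ g ∣ + t)) (∣⁅x⁆∣≡1 a) ⟨
    ∣ q ∣ + (∣ g ∣ + ∣ ⁅ a ⁆ ∣) ≤⟨ venn-≤ (g ∷ p ∷ q ∷ ⁅ a ⁆ ∷ [])
                                         (v0 ⊑ v1 ∥ v2 ∷ v3 ⊑ v1 ∷ v3 ⊑ ~ v2 ∷ v3 ⊑ ~ v0 ∷ [])
                                         (v2 ∷ v0 ∷ v3 ∷ []) (v0 & v2 ∷ v1 ∥ v2 ∷ [])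
                                         (g⊆p∪q ∷ x∈p⇒⁅x⁆⊆p a∈p ∷ x∉p⇒⁅x⁆⊆∁p a∉q ∷ x∉p⇒⁅x⁆⊆∁p a∉g ∷ []) ⟩
    ∣ g ∩ q ∣ + ∣ p ∪ q ∣       ≡⟨ cong (∣ g ∩ q ∣ +_) ∣p∪q∣≡5+j ⟩
    ∣ g ∩ q ∣ + (5 + j)         ∎)))
    where
    open ≤-Reasoning
    rearrange : ∀ j → (2 + j) + (5 + j) ≡ (3 + j) + ((3 + j) + 1)
    rearrange = solve-∀

  four-points-outside : ∀ {e₁ e₂ g h u₁ u₂ a b} → g ⊆ e₁ ∪ e₂ → ∣ e₁ ∪ e₂ ∣ ≡ 5 + j →
                        u₁ ∈ₛ e₁ ─ e₂ → u₁ ∉ₛ h → u₂ ∈ₛ e₂ ─ e₁ → u₂ ∉ₛ g →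
                        a ∈ₛ e₁ ∩ e₂ → a ∉ₛ g → b ∈ₛ e₁ ∩ e₂ → b ∉ₛ h → a ≢ b → Apart g h
  four-points-outside {e₁} {e₂} {g} {h} {u₁} {u₂} {a} {b} g⊆U ∣U∣≡5+j u₁∈ u₁∉h u₂∈ u₂∉g a∈ a∉g b∈ b∉h a≢b =
    s≤s (+-cancelʳ-≤ 4 ∣ g ∩ h ∣ (1 + j) (begin
      ∣ g ∩ h ∣ + 4  ≡⟨ cong (∣ g ∩ h ∣ +_) four-singletons ⟨
      ∣ g ∩ h ∣ + (∣ ⁅ u₁ ⁆ ∣ + (∣ ⁅ u₂ ⁆ ∣ + (∣ ⁅ a ⁆ ∣ + ∣ ⁅ b ⁆ ∣)))
        ≤⟨ venn-≤ (g ∷ h ∷ e₁ ∷ e₂ ∷ ⁅ u₁ ⁆ ∷ ⁅ u₂ ⁆ ∷ ⁅ a ⁆ ∷ ⁅ b ⁆ ∷ [])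
                  (v0 ⊑ v2 ∥ v3 ∷ v4 ⊑ v2 ∖ v3 ∷ v4 ⊑ ~ v1 ∷ v5 ⊑ v3 ∖ v2 ∷ v5 ⊑ ~ v0 ∷
                   v6 ⊑ v2 & v3 ∷ v6 ⊑ ~ v0 ∷ v7 ⊑ v2 & v3 ∷ v7 ⊑ ~ v1 ∷ v6 ⊑ ~ v7 ∷ [])
                  (v0 & v1 ∷ v4 ∷ v5 ∷ v6 ∷ v7 ∷ []) (v2 ∥ v3 ∷ [])
                  (g⊆U ∷ x∈p⇒⁅x⁆⊆p u₁∈ ∷ x∉p⇒⁅x⁆⊆∁p u₁∉h ∷ x∈p⇒⁅x⁆⊆p u₂∈ ∷ x∉p⇒⁅x⁆⊆∁p u₂∉g ∷
                   x∈p⇒⁅x⁆⊆p a∈ ∷ x∉p⇒⁅x⁆⊆∁p a∉g ∷ x∈p⇒⁅x⁆⊆p b∈ ∷ x∉p⇒⁅x⁆⊆∁p b∉h ∷ x≢y⇒⁅x⁆⊆∁⁅y⁆ a≢b ∷ []) ⟩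
      ∣ e₁ ∪ e₂ ∣    ≡⟨ ∣U∣≡5+j ⟩
      5 + j          ≡⟨ +-comm 4 (1 + j) ⟩
      (1 + j) + 4    ∎))
    where
    open ≤-Reasoning
    four-singletons : ∣ ⁅ u₁ ⁆ ∣ + (∣ ⁅ u₂ ⁆ ∣ + (∣ ⁅ a ⁆ ∣ + ∣ ⁅ b ⁆ ∣)) ≡ 4
    four-singletons rewrite ∣⁅x⁆∣≡1 u₁ | ∣⁅x⁆∣≡1 u₂ | ∣⁅x⁆∣≡1 a | ∣⁅x⁆∣≡1 b = refl

  module Close (close : ∀ {f g} → f ∈ E → g ∈ E → 1 + j ≤ ∣ f ∩ g ∣) where

    ∣x∩y∣≡1+j : ∀ {x y} → x ∈ E → y ∈ E → Apart x y → ∣ x ∩ y ∣ ≡ 1 + j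
    ∣x∩y∣≡1+j x∈E y∈E x-apart-y = ≤-antisym (≤-pred x-apart-y) (close x∈E y∈E)

    -- An edge apart from y and missing a point of x ∩ y is adjacent to x (else three edges are
    -- pairwise apart), and then counting forces it into x ∪ y.
    apart-and-missing⇒⊆∪ : ∀ {x y r} → x ∈ E → y ∈ E → Apart x y → r ∈ E → Apart r y → ¬ (x ∩ y ⊆ r) → r ⊆ x ∪ y
    apart-and-missing⇒⊆∪ {x} {y} {r} x∈E y∈E x-apart-y r∈E r-apart-y C⊈r = ⊆∪-by-count j r∈E lower upper
      where
      r-adjacent-x : 2 + j ≤ ∣ r ∩ x ∣
      r-adjacent-x = ≮⇒≥ (λ rx → no-three-apart r∈E x∈E y∈E rx r-apart-y x-apart-y)
      lower : (3 + j) + j ≤ ∣ r ∩ x ∣ + ∣ r ∩ y ∣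
      lower = subst (_≤ ∣ r ∩ x ∣ + ∣ r ∩ y ∣) (+-suc (2 + j) j) (+-mono-≤ r-adjacent-x (close r∈E y∈E))
      upper : ∣ r ∩ (x ∩ y) ∣ ≤ j
      upper = ≤-pred (begin-strict
        ∣ r ∩ (x ∩ y) ∣ ≡⟨ cong ∣_∣ (∩-comm r (x ∩ y)) ⟩
        ∣ (x ∩ y) ∩ r ∣ <⟨ ⊈⇒∣p∩q∣<∣p∣ (x ∩ y) r C⊈r ⟩
        ∣ x ∩ y ∣       ≡⟨ ∣x∩y∣≡1+j x∈E y∈E x-apart-y ⟩
        1 + j           ∎)
        where open ≤-Reasoning

    apart⇒⊆∪ : ∀ {x y r} → x ∈ E → y ∈ E → Apart x y → r ∈ E → Apart r y → ¬ (x ∩ y ⊆ r) →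
               ∀ {f} → f ∈ E → Apart f y → f ⊆ x ∪ y
    apart⇒⊆∪ {x} {y} {r} x∈E y∈E x-apart-y r∈E r-apart-y C⊈r {f} f∈E f-apart-y with x ∩ y ⊆? f
    ... | no C⊈f = apart-and-missing⇒⊆∪ x∈E y∈E x-apart-y f∈E f-apart-y C⊈f
    ... | yes C⊆f with f ⊆? x ∪ y
    ...   | yes f⊆U = f⊆U
    ...   | no f⊈U  = contradiction (apart-from-missing r⊆U C⊈r f∈E C⊆f f⊈U) (λ f-apart-r →
                        no-three-apart f∈E r∈E y∈E f-apart-r f-apart-y r-apart-y)
      where r⊆U = apart-and-missing⇒⊆∪ x∈E y∈E x-apart-y r∈E r-apart-y C⊈r

    module SpreadSide {x y : Subset n} (x∈E : x ∈ E) (y∈E : y ∈ E) (x-apart-y : Apart x y)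
                      (⊆x∪y : ∀ {f} → f ∈ E → f ⊆ x ∪ y) (∣x∪y∣≡5+j : ∣ x ∪ y ∣ ≡ 5 + j)
                      (sp : ApartFrom.Spread y∈E x∈E x-apart-y) where

      open ApartFrom.Spread y∈E x∈E x-apart-y sp public

      span⊆x∪y : span ⊆ x ∪ y
      span⊆x∪y = p⊆r∧q⊆r⇒p∪q⊆r (⊆x∪y (proj₁ (∈apartFrom⁻ w₁∈F))) (p⊆p∪q y)

      ∣x∪y─span∣≡1 : ∣ (x ∪ y) ─ span ∣ ≡ 1
      ∣x∪y─span∣≡1 = ∣p∩q∣≡m⇒∣p─q∣≡k (x ∪ y) span ∣x∪y∣≡5+j (trans (∣p∩q∣≡∣q∣ (x ∪ y) span span⊆x∪y) ∣span∣≡2+m)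

      u : Fin n
      u = proj₁ (∣p∣≡1⇒singleton ((x ∪ y) ─ span) ∣x∪y─span∣≡1)

      x∪y─span≡⁅u⁆ : (x ∪ y) ─ span ≡ ⁅ u ⁆
      x∪y─span≡⁅u⁆ = proj₂ (∣p∣≡1⇒singleton ((x ∪ y) ─ span) ∣x∪y─span∣≡1)

      u∈x∪y─span : u ∈ₛ (x ∪ y) ─ span
      u∈x∪y─span = subst (u ∈ₛ_) (sym x∪y─span≡⁅u⁆) (x∈⁅x⁆ u)

      u∉apartFrom : ∀ {f} → f ∈ apartFrom y → u ∉ₛ f
      u∉apartFrom {f} f∈F u∈f = x∈∁p⇒x∉p u∈∁f u∈f
        where u∈∁f = venn-⊆ (f ∷ x ∷ y ∷ span ∷ []) (v0 ⊑ v3 ∷ []) ((v1 ∥ v2) ∖ v3 ⊑ ~ v0) (⊆span f∈F ∷ []) u∈x∪y─span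

      u∈y─x : u ∈ₛ y ─ x
      u∈y─x = venn-⊆ (x ∷ y ∷ span ∷ []) (v0 ⊑ v2 ∷ []) ((v0 ∥ v1) ∖ v2 ⊑ v1 ∖ v0)
                     (⊆span (∈apartFrom⁺ x∈E x-apart-y) ∷ []) u∈x∪y─span

      outside-span⇒∋u : ∀ {f} → f ∈ E → ¬ (f ⊆ span) → u ∈ₛ f
      outside-span⇒∋u {f} f∈E f⊈span with u ∈? f
      ... | yes u∈f = u∈f
      ... | no u∉f  = ⊥-elim (f⊈span (venn-⊆ (f ∷ x ∷ y ∷ span ∷ ⁅ u ⁆ ∷ [])
                                           (v0 ⊑ v1 ∥ v2 ∷ (v1 ∥ v2) ∖ v3 ⊑ v4 ∷ v4 ⊑ ~ v0 ∷ []) (v0 ⊑ v3)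
                                           (⊆x∪y f∈E ∷ ⊆-reflexive x∪y─span≡⁅u⁆ ∷ x∉p⇒⁅x⁆⊆∁p u∉f ∷ [])))

      cover-with-sunflower : ∀ S → ∣ S ∣ ≡ 2 + j → (∀ {f} → f ∈ apartFrom x → S ⊆ f) →
                             Cover (2 + j) (_∈ E) (half + 2)
      cover-with-sunflower S ∣S∣≡2+j S⊆ =
        cover-∪ (PairCover.pair-cover span ∣span∣≡2+m)
                (cover-⊎ (singleton-cover S ∣S∣≡2+j S⊆) (singleton-cover ((x ∩ y) ∪ ⁅ u ⁆) ∣C∪⁅u⁆∣≡2+j id)) split
        where
        ∣C∪⁅u⁆∣≡2+j = ∣x∩y∪⁅z⁆∣≡2+j (∣x∩y∣≡1+j x∈E y∈E x-apart-y) u∈y─x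
        split : ∀ {f} → f ∈ E → (∣ f ∣ ≡ 3 + j × f ⊆ span) ⊎ (f ∈ apartFrom x ⊎ (x ∩ y) ∪ ⁅ u ⁆ ⊆ f)
        split {f} f∈E with apart? f y | apart? f x
        ... | yes fy | _      = inj₁ (∣e∣≡3+j f∈E , ⊆span (∈apartFrom⁺ f∈E fy))
        ... | no _   | yes fx = inj₂ (inj₁ (∈apartFrom⁺ f∈E fx))
        ... | no ¬fy | no ¬fx with f ⊆? span
        ...   | yes f⊆span = inj₁ (∣e∣≡3+j f∈E , f⊆span)
        ...   | no f⊈span  = inj₂ (inj₂ (p⊆r∧q⊆r⇒p∪q⊆r C⊆f (x∈p⇒⁅x⁆⊆p (outside-span⇒∋u f∈E f⊈span))))
          where C⊆f = adjacent-to-both⇒x∩y⊆f (∣x∩y∣≡1+j x∈E y∈E x-apart-y) f∈E ¬fx ¬fy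

    module Crossing {e₁ e₂ r₁ r₂ : Subset n} (e₁∈E : e₁ ∈ E) (e₂∈E : e₂ ∈ E) (e₁-apart-e₂ : Apart e₁ e₂)
                    (r₁∈E : r₁ ∈ E) (r₁-apart-e₁ : Apart r₁ e₁) (C⊈r₁ : ¬ (e₁ ∩ e₂ ⊆ r₁))
                    (r₂∈E : r₂ ∈ E) (r₂-apart-e₂ : Apart r₂ e₂) (C⊈r₂ : ¬ (e₁ ∩ e₂ ⊆ r₂)) where

      e₂-apart-e₁ : Apart e₂ e₁
      e₂-apart-e₁ = apart-sym {e₁} e₁-apart-e₂

      ∣e₁∩e₂∣≡1+j : ∣ e₁ ∩ e₂ ∣ ≡ 1 + j
      ∣e₁∩e₂∣≡1+j = ∣x∩y∣≡1+j e₁∈E e₂∈E e₁-apart-e₂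

      ⊆e₁∪e₂ : ∀ {f} → f ∈ E → f ⊆ e₁ ∪ e₂
      ⊆e₁∪e₂ {f} f∈E with apart? f e₂ | apart? f e₁
      ... | yes fe₂ | _       = apart⇒⊆∪ e₁∈E e₂∈E e₁-apart-e₂ r₂∈E r₂-apart-e₂ C⊈r₂ f∈E fe₂
      ... | no _    | yes fe₁ = subst (f ⊆_) (∪-comm e₂ e₁)
        (apart⇒⊆∪ e₂∈E e₁∈E e₂-apart-e₁ r₁∈E r₁-apart-e₁ (C⊈r₁ ∘ subst (_⊆ r₁) (∩-comm e₂ e₁)) f∈E fe₁)
      ... | no ¬fe₂ | no ¬fe₁ = ⊆∪-by-count (1 + j) f∈E
        (subst (_≤ ∣ f ∩ e₁ ∣ + ∣ f ∩ e₂ ∣) (sym [3+j]+[1+j]≡[2+j]+[2+j]) (+-mono-≤ (≮⇒≥ ¬fe₁) (≮⇒≥ ¬fe₂)))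
        (subst (∣ f ∩ (e₁ ∩ e₂) ∣ ≤_) ∣e₁∩e₂∣≡1+j (∣p∩q∣≤∣q∣ f (e₁ ∩ e₂)))

      ⊆e₂∪e₁ : ∀ {f} → f ∈ E → f ⊆ e₂ ∪ e₁
      ⊆e₂∪e₁ {f} f∈E = subst (f ⊆_) (∪-comm e₁ e₂) (⊆e₁∪e₂ f∈E)

      ∣e₁∪e₂∣≡5+j : ∣ e₁ ∪ e₂ ∣ ≡ 5 + j
      ∣e₁∪e₂∣≡5+j = +-cancelʳ-≡ (1 + j) ∣ e₁ ∪ e₂ ∣ (5 + j) (begin
        ∣ e₁ ∪ e₂ ∣ + (1 + j)         ≡⟨ cong (∣ e₁ ∪ e₂ ∣ +_) ∣e₁∩e₂∣≡1+j ⟨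
        ∣ e₁ ∪ e₂ ∣ + ∣ e₁ ∩ e₂ ∣     ≡⟨ ∣p∪q∣+∣p∩q∣≡∣p∣+∣q∣ e₁ e₂ ⟩
        ∣ e₁ ∣ + ∣ e₂ ∣               ≡⟨ cong₂ _+_ (∣e∣≡3+j e₁∈E) (∣e∣≡3+j e₂∈E) ⟩
        (3 + j) + (3 + j)             ≡⟨ rearrange j ⟩
        (5 + j) + (1 + j)             ∎)
        where
        open ≡-Reasoning
        rearrange : ∀ j → (3 + j) + (3 + j) ≡ (5 + j) + (1 + j)
        rearrange = solve-∀

      ∣e₂∪e₁∣≡5+j : ∣ e₂ ∪ e₁ ∣ ≡ 5 + j
      ∣e₂∪e₁∣≡5+j = trans (cong ∣_∣ (∪-comm e₂ e₁)) ∣e₁∪e₂∣≡5+j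

      module Side₂ = SpreadSide e₁∈E e₂∈E e₁-apart-e₂ ⊆e₁∪e₂ ∣e₁∪e₂∣≡5+j
      module Side₁ = SpreadSide e₂∈E e₁∈E e₂-apart-e₁ ⊆e₂∪e₁ ∣e₂∪e₁∣≡5+j

      module BothSpread (sp₂ : ApartFrom.Spread e₂∈E e₁∈E e₁-apart-e₂)
                        (sp₁ : ApartFrom.Spread e₁∈E e₂∈E e₂-apart-e₁) where

        module S₂ = Side₂ sp₂
        module S₁ = Side₁ sp₁

        h : Subset n
        h = S₁.w₁
        h∈E = proj₁ (∈apartFrom⁻ S₁.w₁∈F)
        h-apart-e₁ = proj₂ (∈apartFrom⁻ S₁.w₁∈F)

        ∣w∩e₁∣≡2+j : ∀ {w} → w ∈ apartFrom e₂ → w ≢ e₁ → ∣ w ∩ e₁ ∣ ≡ 2 + j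
        ∣w∩e₁∣≡2+j = ApartFrom.∣f∩e∣≡m e₂∈E e₁∈E e₁-apart-e₂

        h-misses : ∃ λ b → e₂ ─ h ≡ ⁅ b ⁆
        h-misses = missed-point e₂∈E (ApartFrom.∣f∩e∣≡m e₁∈E e₂∈E e₂-apart-e₁ S₁.w₁∈F S₁.w₁≢e)

        b : Fin n
        b = proj₁ h-misses

        b∈e₂─h : b ∈ₛ e₂ ─ h
        b∈e₂─h = subst (b ∈ₛ_) (sym (proj₂ h-misses)) (x∈⁅x⁆ b)

        b∈e₁∩e₂ : b ∈ₛ e₁ ∩ e₂
        b∈e₁∩e₂ = x∈p∩q⁺ (missed-point-in-other e₁∈E h∈E (⊆e₂∪e₁ h∈E) ∣e₂∪e₁∣≡5+j h-apart-e₁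
                                                (p─q⊆p e₂ h b∈e₂─h) (x∈p─q⇒x∉q b∈e₂─h) ,
                          p─q⊆p e₂ h b∈e₂─h)

        -- With h from the spread of apartFrom e₁ and a suitable g from that of apartFrom e₂,
        -- g, h and f would be pairwise apart.
        no-edge-outside-both-spans : ∀ {f} → f ∈ E → ¬ Apart f e₁ → ¬ Apart f e₂ →
                                     ¬ (f ⊆ S₂.span) → ¬ (f ⊆ S₁.span) → Data.Empty.⊥
        no-edge-outside-both-spans {f} f∈E ¬fe₁ ¬fe₂ f⊈span₂ f⊈span₁ =
          choose (missed-point e₁∈E (∣w∩e₁∣≡2+j S₂.w₁∈F S₂.w₁≢e)) (missed-point e₁∈E (∣w∩e₁∣≡2+j S₂.w₂∈F S₂.w₂≢e))
          where
          h-apart-f : Apart h f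
          h-apart-f = apart-via-private-point e₂∈E h∈E f∈E (⊆e₁∪e₂ h∈E) (⊆e₁∪e₂ f∈E) h-apart-e₁ S₁.w₁≢e ¬fe₁ ¬fe₂
                        S₁.u∈y─x (S₁.u∉apartFrom S₁.w₁∈F) (S₁.outside-span⇒∋u f∈E f⊈span₁)
          refute : ∀ {g a} → g ∈ apartFrom e₂ → g ≢ e₁ → e₁ ─ g ≡ ⁅ a ⁆ → a ≢ b → Data.Empty.⊥
          refute {g} {a} g∈F g≢e₁ e₁─g≡⁅a⁆ a≢b = no-three-apart g∈E h∈E f∈E g-apart-h g-apart-f h-apart-f
            where
            g∈E = proj₁ (∈apartFrom⁻ g∈F)
            g-apart-e₂ = proj₂ (∈apartFrom⁻ g∈F)
            a∈e₁─g : a ∈ₛ e₁ ─ g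
            a∈e₁─g = subst (a ∈ₛ_) (sym e₁─g≡⁅a⁆) (x∈⁅x⁆ a)
            a∈e₁∩e₂ : a ∈ₛ e₁ ∩ e₂
            a∈e₁∩e₂ = x∈p∩q⁺ (p─q⊆p e₁ g a∈e₁─g ,
                              missed-point-in-other e₂∈E g∈E (⊆e₁∪e₂ g∈E) ∣e₁∪e₂∣≡5+j g-apart-e₂
                                                    (p─q⊆p e₁ g a∈e₁─g) (x∈p─q⇒x∉q a∈e₁─g))
            g-apart-f : Apart g f
            g-apart-f = apart-via-private-point e₁∈E g∈E f∈E (⊆e₂∪e₁ g∈E) (⊆e₂∪e₁ f∈E) g-apart-e₂ g≢e₁ ¬fe₂ ¬fe₁
                          S₂.u∈y─x (S₂.u∉apartFrom g∈F) (S₂.outside-span⇒∋u f∈E f⊈span₂)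
            g-apart-h : Apart g h
            g-apart-h = four-points-outside (⊆e₁∪e₂ g∈E) ∣e₁∪e₂∣≡5+j
                          S₁.u∈y─x (S₁.u∉apartFrom S₁.w₁∈F) S₂.u∈y─x (S₂.u∉apartFrom g∈F)
                          a∈e₁∩e₂ (x∈p─q⇒x∉q a∈e₁─g) b∈e₁∩e₂ (x∈p─q⇒x∉q b∈e₂─h) a≢b
          choose : (∃ λ a → e₁ ─ S₂.w₁ ≡ ⁅ a ⁆) → (∃ λ a → e₁ ─ S₂.w₂ ≡ ⁅ a ⁆) → Data.Empty.⊥
          choose (a₁ , e₁─w₁≡⁅a₁⁆) (a₂ , e₁─w₂≡⁅a₂⁆) with a₁ ≟ b
          ... | no a₁≢b  = refute S₂.w₁∈F S₂.w₁≢e e₁─w₁≡⁅a₁⁆ a₁≢b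
          ... | yes a₁≡b = refute S₂.w₂∈F S₂.w₂≢e e₁─w₂≡⁅a₂⁆ λ a₂≡b → S₂.w₁∩e≢w₂∩e (begin
            S₂.w₁ ∩ e₁ ≡⟨ p─q≡⁅x⁆⇒q∩p≡p-x e₁ S₂.w₁ e₁─w₁≡⁅a₁⁆ ⟩
            e₁ - a₁    ≡⟨ cong (e₁ -_) (trans a₁≡b (sym a₂≡b)) ⟩
            e₁ - a₂    ≡⟨ p─q≡⁅x⁆⇒q∩p≡p-x e₁ S₂.w₂ e₁─w₂≡⁅a₂⁆ ⟨
            S₂.w₂ ∩ e₁ ∎)
            where open ≡-Reasoning

        both-spread-cover : Cover (2 + j) (_∈ E) (half + half)
        both-spread-cover =
          cover-∪ (PairCover.pair-cover S₂.span S₂.∣span∣≡2+m) (PairCover.pair-cover S₁.span S₁.∣span∣≡2+m) split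
          where
          split : ∀ {f} → f ∈ E → (∣ f ∣ ≡ 3 + j × f ⊆ S₂.span) ⊎ (∣ f ∣ ≡ 3 + j × f ⊆ S₁.span)
          split {f} f∈E with apart? f e₂ | apart? f e₁
          ... | yes fe₂ | _       = inj₁ (∣e∣≡3+j f∈E , S₂.⊆span (∈apartFrom⁺ f∈E fe₂))
          ... | no _    | yes fe₁ = inj₂ (∣e∣≡3+j f∈E , S₁.⊆span (∈apartFrom⁺ f∈E fe₁))
          ... | no ¬fe₂ | no ¬fe₁ with f ⊆? S₂.span | f ⊆? S₁.span
          ...   | yes f⊆span₂ | _           = inj₁ (∣e∣≡3+j f∈E , f⊆span₂)
          ...   | no _        | yes f⊆span₁ = inj₂ (∣e∣≡3+j f∈E , f⊆span₁)
          ...   | no f⊈span₂  | no f⊈span₁  = ⊥-elim (no-edge-outside-both-spans f∈E ¬fe₁ ¬fe₂ f⊈span₂ f⊈span₁)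

      crossing-cover : Cover (2 + j) (_∈ E) (half + half)
      crossing-cover with ApartFrom.shape e₂∈E e₁∈E e₁-apart-e₂ | ApartFrom.shape e₁∈E e₂∈E e₂-apart-e₁
      ... | ApartFrom.sunflower S₂ ∣S₂∣≡2+j S₂⊆ | ApartFrom.sunflower S₁ ∣S₁∣≡2+j S₁⊆ =
        cover-weaken 4≤half+half
          (cover-∪ (cover-⊎ (singleton-cover S₂ ∣S₂∣≡2+j S₂⊆) (singleton-cover S₁ ∣S₁∣≡2+j S₁⊆))
                   (two-point-cover e₂∈E ∣e₁∩e₂∣≡1+j) split)
        where
        split : ∀ {f} → f ∈ E → (f ∈ apartFrom e₂ ⊎ f ∈ apartFrom e₁) ⊎ (e₁ ∩ e₂ ⊆ f × ¬ Apart f e₂)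
        split {f} f∈E with apart? f e₂ | apart? f e₁
        ... | yes fe₂ | _       = inj₁ (inj₁ (∈apartFrom⁺ f∈E fe₂))
        ... | no _    | yes fe₁ = inj₁ (inj₂ (∈apartFrom⁺ f∈E fe₁))
        ... | no ¬fe₂ | no ¬fe₁ = inj₂ (adjacent-to-both⇒x∩y⊆f ∣e₁∩e₂∣≡1+j f∈E ¬fe₁ ¬fe₂ , ¬fe₂)
      ... | ApartFrom.spread sp₂ | ApartFrom.sunflower S₁ ∣S₁∣≡2+j S₁⊆ =
        cover-weaken half+2≤half+half (Side₂.cover-with-sunflower sp₂ S₁ ∣S₁∣≡2+j S₁⊆)
      ... | ApartFrom.sunflower S₂ ∣S₂∣≡2+j S₂⊆ | ApartFrom.spread sp₁ =
        cover-weaken half+2≤half+half (Side₁.cover-with-sunflower sp₁ S₂ ∣S₂∣≡2+j S₂⊆)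
      ... | ApartFrom.spread sp₂ | ApartFrom.spread sp₁ = BothSpread.both-spread-cover sp₂ sp₁

    none-missing⇒⊇ : ∀ {C e} → ¬ Any (λ r → Apart r e × ¬ (C ⊆ r)) E → ∀ {f} → f ∈ E → Apart f e → C ⊆ f
    none-missing⇒⊇ {C} ∄r {f} f∈E fe = decidable-stable (C ⊆? f) (λ C⊈f → ∄r (lose f∈E (fe , C⊈f)))

    close-cover : ∀ {e₁ e₂} → e₁ ∈ E → e₂ ∈ E → Apart e₁ e₂ → Cover (2 + j) (_∈ E) (half + half)
    close-cover {e₁} {e₂} e₁∈E e₂∈E e₁-apart-e₂
      with any? (λ r → apart? r e₁ ×-dec ¬? (e₁ ∩ e₂ ⊆? r)) E | any? (λ r → apart? r e₂ ×-dec ¬? (e₁ ∩ e₂ ⊆? r)) E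
    ... | no ∄r₁ | _ = cover-weaken half+2≤half+half
      (cover-if-apart⇒⊇∩ e₁∈E e₂∈E e₁-apart-e₂ (∣x∩y∣≡1+j e₁∈E e₂∈E e₁-apart-e₂) (none-missing⇒⊇ ∄r₁))
    ... | yes _ | no ∄r₂ = cover-weaken half+2≤half+half
      (cover-if-apart⇒⊇∩ e₂∈E e₁∈E e₂-apart-e₁ (∣x∩y∣≡1+j e₂∈E e₁∈E e₂-apart-e₁)
        λ f∈E fe₂ → subst (_⊆ _) (∩-comm e₁ e₂) (none-missing⇒⊇ ∄r₂ f∈E fe₂))
      where e₂-apart-e₁ = apart-sym {e₁} e₁-apart-e₂
    ... | yes ∃r₁ | yes ∃r₂ with find ∃r₁ | find ∃r₂
    ...   | _ , r₁∈E , r₁-apart-e₁ , C⊈r₁ | _ , r₂∈E , r₂-apart-e₂ , C⊈r₂ =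
      Crossing.crossing-cover e₁∈E e₂∈E e₁-apart-e₂ r₁∈E r₁-apart-e₁ C⊈r₁ r₂∈E r₂-apart-e₂ C⊈r₂

  edge-cover : ∀ {e₁ e₂} → e₁ ∈ E → e₂ ∈ E → Apart e₁ e₂ → Cover (2 + j) (_∈ E) (half + half)
  edge-cover e₁∈E e₂∈E e₁-apart-e₂ with any? (λ f → any? (λ g → ∣ f ∩ g ∣ ≤? j) E) E
  ... | yes ∃far with find ∃far
  ...   | _ , f₀∈E , ∃g₀ with find ∃g₀
  ...     | _ , g₀∈E , ∣f₀∩g₀∣≤j = far-pair-cover f₀∈E g₀∈E ∣f₀∩g₀∣≤j
  edge-cover e₁∈E e₂∈E e₁-apart-e₂ | no ∄far = Close.close-cover close e₁∈E e₂∈E e₁-apart-e₂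
    where
    close : ∀ {f g} → f ∈ E → g ∈ E → 1 + j ≤ ∣ f ∩ g ∣
    close f∈E g∈E = ≰⇒> (λ ∣f∩g∣≤j → ∄far (lose f∈E (lose g∈E ∣f∩g∣≤j)))

τ≤-of-cover : ∀ {n k m b} {H : Hypergraph n k} → Cover m (_∈ edges H) b → τ≤ m H b
τ≤-of-cover (cover C ∣C∣≤b sizes covers) = C , (sizes , λ _ → covers) , ∣C∣≤b

theorem1 : (n k : ℕ) → 3 ≤ k → (H : Hypergraph n k) →
           ν≡ (k ∸ 1) H 2 → τ≤ (k ∸ 1) H (2 * ⌈ k + 1 /2⌉)
theorem1 n 0 () H
theorem1 n 1 (s≤s ()) H
theorem1 n 2 (s≤s (s≤s ())) H
theorem1 n (suc (suc (suc j))) _ H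
         ((_ ∷ _ ∷ [] , ((e₁∈E ∷ e₂∈E ∷ []) , ((_ , e₁-apart-e₂) ∷ []) ∷ _) , refl) , ν≤2) =
  τ≤-of-cover {H = H} (cover-weaken (≤-reflexive half+half≡) (TwoMatching.edge-cover H ν≤2 e₁∈E e₂∈E e₁-apart-e₂))
  where
  half+half≡ : ⌈ 4 + j /2⌉ + ⌈ 4 + j /2⌉ ≡ 2 * ⌈ 3 + j + 1 /2⌉
  half+half≡ = trans (cong (⌈ 4 + j /2⌉ +_) (sym (+-identityʳ _))) (cong (λ t → 2 * ⌈ t /2⌉) (+-comm 1 (3 + j)))
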